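{- Let $n,s\ge 0$. There is a bijection from $\mathrm{WSP}_n(s)$ onto the set of sequences $(i,j,k,\binom{c'}{w'},v^e,v^o)$ where $i,j,k$ are nonnegative integers with $i+j+k=n$, $\binom{c'}{w'}\in\mathrm{WSD}_i(s)$, $v^e\in\mathrm{NIW}^e_j(s)$ and $v^o\in\mathrm{DW}^o_k(s)$, such that whenever $\binom{c}{w}$ is mapped to $(i,j,k,\binom{c'}{w'},v^e,v^o)$ we have $$\mathrm{tot}\,c=\mathrm{tot}\,c'+\mathrm{tot}\,v^e+\mathrm{tot}\,v^o,\quad \mathrm{neg}\,w=\mathrm{neg}\,w'+\lambda(v^o),\quad \mathrm{fix}^+w=\lambda(v^e),\quad \mathrm{fix}^-w=\lambda(v^o).$$
   Context: For a word $c=c_1\cdots c_n$ of nonnegative integers, $\lambda(c)=n$ and $\mathrm{tot}\,c=c_1+\cdots+c_n$. $\mathrm{NIW}_n$ is the set of nonincreasing words of length $n$ of nonnegative integers; $\mathrm{NIW}^e_n(s)$ is the set of nonincreasing words of length $n$ all of whose letters are even integers in $\{0,\dots,s\}$; $\mathrm{DW}^o_n(s)$ is the set of strictly decreasing words of length $n$ all of whose letters are odd integers in $\{0,\dots,s\}$. $B_n$ is the set of signed permutations $w=x_1\cdots x_n$ ($x_i\in\{\pm1,\dots,\pm n\}$, $|x_1|\cdots|x_n|$ a permutation of $1\cdots n$); $\mathrm{neg}\,w$ is the number of negative letters, $\mathrm{fix}^+w=\#\{i>0:x_i=i\}$, $\mathrm{fix}^-w=\#\{i>0:x_i=-i\}$.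 A weighted signed permutation of order $n$ is a pair $\binom{c}{w}$ with $c=c_1\cdots c_n\in\mathrm{NIW}_n$, $w=x_1\cdots x_n\in B_n$, such that $c_k=c_{k+1}\Rightarrow x_k<x_{k+1}$ for $k=1,\dots,n-1$, and $x_k>0$ when $c_k$ is even, $x_k<0$ when $c_k$ is odd. It is a weighted signed derangement if $w$ has no fixed points (positive or negative). $\mathrm{WSP}_n(s)$ (resp. $\mathrm{WSD}_n(s)$) is the set of weighted signed permutations (resp. derangements) of order $n$ with $c_1\le s$ (for $n=0$ it consists of the empty pair). -}

module Defs where

open import Data.Nat as ℕ using (ℕ; zero; suc; _+_; _≤_; _≥_; _>_; _%_)
open import Data.Integer as ℤ using (ℤ; +_; -_; ∣_∣)
open import Data.Integer.Properties as ℤP using ()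
open import Data.List as L using (List; []; _∷_; upTo)
open import Data.Nat.ListAction using (sum)
open import Data.List.Relation.Unary.Linked using (Linked)
open import Data.List.Relation.Unary.All using (All)
open import Data.List.Relation.Binary.Permutation.Propositional using (_↭_)
open import Data.Vec as V using (Vec; toList)
open import Data.Fin using (Fin; toℕ)
open import Data.Product using (Σ; _×_; _,_; proj₁; ∃-syntax)
open import Data.Unit using (⊤)
open import Relation.Binary.PropositionalEquality using (_≡_; _≢_)
open import Relation.Nullary using (yes; no)

Even : ℕ → Set
Even m = m % 2 ≡ 0

Odd : ℕ → Set
Odd m = m % 2 ≡ 1

tot : ∀ {n} → Vec ℕ n → ℕ
tot c = sum (toList c)

HeadBound : ℕ → List ℕ → Set
HeadBound s []      = ⊤
HeadBound s (x ∷ _) = x ≤ s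

NonIncreasing : List ℕ → Set
NonIncreasing = Linked _≥_

StrictlyDecreasing : List ℕ → Set
StrictlyDecreasing = Linked _>_

NIWe : (j s : ℕ) → Set
NIWe j s = Σ (Vec ℕ j) λ v →
  NonIncreasing (toList v) × All (λ x → Even x × x ≤ s) (toList v)

DWo : (k s : ℕ) → Set
DWo k s = Σ (Vec ℕ k) λ v →
  StrictlyDecreasing (toList v) × All (λ x → Odd x × x ≤ s) (toList v)

IsSignedPerm : ∀ {n} → Vec ℤ n → Set
IsSignedPerm {n} w = L.map ∣_∣ (toList w) ↭ L.map suc (upTo n)

neg : List ℤ → ℕ
neg []       = 0
neg (x ∷ xs) with x ℤP.<? + 0
... | yes _ = suc (neg xs)
... | no  _ = neg xs

fixPlusFrom : ℕ → List ℤ → ℕ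
fixPlusFrom i []       = 0
fixPlusFrom i (x ∷ xs) with x ℤP.≟ + i
... | yes _ = suc (fixPlusFrom (suc i) xs)
... | no  _ = fixPlusFrom (suc i) xs

fixMinusFrom : ℕ → List ℤ → ℕ
fixMinusFrom i []       = 0
fixMinusFrom i (x ∷ xs) with x ℤP.≟ - (+ i)
... | yes _ = suc (fixMinusFrom (suc i) xs)
... | no  _ = fixMinusFrom (suc i) xs

fix⁺ : ∀ {n} → Vec ℤ n → ℕ
fix⁺ w = fixPlusFrom 1 (toList w)

fix⁻ : ∀ {n} → Vec ℤ n → ℕ
fix⁻ w = fixMinusFrom 1 (toList w)

negV : ∀ {n} → Vec ℤ n → ℕ
negV w = neg (toList w)

TieCond : ℕ × ℤ → ℕ × ℤ → Set
TieCond (c , x) (c' , x') = c ≡ c' → x ℤ.< x'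

SignCond : ℕ × ℤ → Set
SignCond (c , x) = (Even c → + 0 ℤ.< x) × (Odd c → x ℤ.< + 0)

IsWSP : (n s : ℕ) → Vec ℕ n × Vec ℤ n → Set
IsWSP n s (c , w) =
  NonIncreasing (toList c) ×
  IsSignedPerm w ×
  Linked TieCond (toList (V.zip c w)) ×
  All SignCond (toList (V.zip c w)) ×
  HeadBound s (toList c)

NoFixedPoints : ∀ {n} → Vec ℤ n → Set
NoFixedPoints {n} w = (i : Fin n) →
  (V.lookup w i ≢ + suc (toℕ i)) × (V.lookup w i ≢ - (+ suc (toℕ i)))

IsWSD : (n s : ℕ) → Vec ℕ n × Vec ℤ n → Set
IsWSD n s (c , w) = IsWSP n s (c , w) × NoFixedPoints w

WSP : (n s : ℕ) → Set
WSP n s = Σ (Vec ℕ n × Vec ℤ n) (IsWSP n s)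

WSD : (n s : ℕ) → Set
WSD n s = Σ (Vec ℕ n × Vec ℤ n) (IsWSD n s)

TupleData : Set
TupleData = Σ (ℕ × ℕ × ℕ) λ { (i , j , k) →
  (Vec ℕ i × Vec ℤ i) × Vec ℕ j × Vec ℕ k }

IsTarget : (n s : ℕ) → TupleData → Set
IsTarget n s ((i , j , k) , cw , ve , vo) =
  (i + j + k ≡ n) ×
  IsWSD i s cw ×
  (NonIncreasing (toList ve) × All (λ x → Even x × x ≤ s) (toList ve)) ×
  (StrictlyDecreasing (toList vo) × All (λ x → Odd x × x ≤ s) (toList vo))

Target : (n s : ℕ) → Set
Target n s = Σ TupleData (IsTarget n s)

StatsOK : (n s : ℕ) → WSP n s → Target n s → Set
StatsOK n s ((c , w) , _) (((i , j , k) , (c' , w') , ve , vo) , _) =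
  (tot c ≡ tot c' + tot ve + tot vo) ×
  (negV w ≡ negV w' + k) ×
  (fix⁺ w ≡ j) ×
  (fix⁻ w ≡ k)

-- a bijection between subsets (elements compared by their underlying data,
-- the membership proofs being irrelevant)
IsBijection : ∀ {A B : Set} {P : A → Set} {Q : B → Set} →
              (Σ A P → Σ B Q) → Set
IsBijection {A} {B} {P} {Q} f =
  ((x y : Σ A P) → proj₁ x ≡ proj₁ y → proj₁ (f x) ≡ proj₁ (f y)) ×
  ((x y : Σ A P) → proj₁ (f x) ≡ proj₁ (f y) → proj₁ x ≡ proj₁ y) ×
  ((y : Σ B Q) → Σ (Σ A P) λ x → proj₁ (f x) ≡ proj₁ y)

module Submission where

-- A weighted signed permutation is encoded by the list of pairs (cₖ , ∣xₖ∣), the sign of xₖ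
-- being determined by the parity of cₖ. Deleting the leftmost fixed point, of weight v, and
-- renumbering the remaining absolute values gives a weighted signed permutation of order n − 1
-- with the same first weight bound; it is undone by inserting a fixed point of weight v at the
-- unique place allowed by the tie condition, provided v dominates the weights of the fixed points
-- still present. Iterating yields a derangement together with the weights of the deleted fixed
-- points, read left to right: a nonincreasing word in which no odd weight (negative fixed point)
-- repeats, i.e. the merge of its even part vᵉ ∈ NIWᵉ and its odd part vᵒ ∈ DWᵒ. Weights are only
-- moved around, so tot and neg are redistributed, while fix⁺ and fix⁻ count vᵉ and vᵒ.

open import Defs
open import Data.Bool as Bool using (Bool; true; false)
open import Data.Empty using (⊥; ⊥-elim)
open import Data.Fin as Fin using (Fin; toℕ)
open import Data.Integer as ℤ using (ℤ; +_; -[1+_]; -_; ∣_∣)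
import Data.Integer.Properties as ℤ
open import Data.List using (List; []; _∷_; _++_; map; length; last; filter; merge; upTo; applyUpTo)
open import Data.List.Properties
  using ( map-++; length-++; length-map; map-∘; map-cong; map-id; map-applyUpTo; ++-identityʳ
        ; filter-accept; filter-reject)
open import Data.List.Membership.Propositional using (_∈_)
open import Data.List.Membership.Propositional.Properties using (∈-insert)
open import Data.List.Relation.Unary.All as All using (All; []; _∷_)
import Data.List.Relation.Unary.All.Properties as All
open import Data.List.Relation.Unary.AllPairs using (_∷_)
open import Data.List.Relation.Unary.Any using (here; there)
open import Data.List.Relation.Unary.Linked as Linked using (Linked; []; [-]; _∷_)
import Data.List.Relation.Unary.Linked.Properties as Linked
open import Data.List.Relation.Binary.Permutation.Propositional
  using (_↭_; ↭-sym; ↭-trans; ↭-reflexive; prep)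
open import Data.List.Relation.Binary.Permutation.Propositional.Properties
  using (shift; drop-mid; map⁺; All-resp-↭; ∈-resp-↭; ↭-length; merge-↭)
open import Data.Maybe as Maybe using (Maybe; just; nothing)
open import Data.Maybe.Relation.Binary.Connected using (Connected; just; nothing-just)
open import Data.Nat
open import Data.Nat.DivMod using ([m+n]%n≡m%n)
open import Data.Nat.ListAction using (sum)
open import Data.Nat.ListAction.Properties using (sum-++; sum-↭)
open import Data.Nat.Properties
open import Data.Product using (Σ; _×_; _,_; proj₁; proj₂; map₁; map₂)
open import Data.Sum using (_⊎_; inj₁; inj₂)
open import Data.Unit using (⊤; tt)
open import Data.Vec as Vec using (Vec; toList; fromList)
open import Data.Vec.Properties using (toList∘fromList; length-toList)
open import Function using (_∘_; id)
open import Relation.Binary.Definitions using (Transitive)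
open import Relation.Binary.PropositionalEquality
open import Relation.Nullary using (¬_; Dec; yes; no)
open import Relation.Nullary.Decidable using (_×-dec_; _⊎-dec_)
open import Relation.Nullary.Reflects using (ofʸ; ofⁿ)

module _ {A : Set} {R : A → A → Set} where

  Linked-head-All : Transitive R → ∀ {x l} → Linked R (x ∷ l) → All (R x) l
  Linked-head-All trans lk with Linked.Linked⇒AllPairs trans lk
  ... | Rx ∷ _ = Rx

  Linked-∷⁺ : ∀ {x l} → All (R x) l → Linked R l → Linked R (x ∷ l)
  Linked-∷⁺ []        _  = [-]
  Linked-∷⁺ (Rxy ∷ _) lk = Rxy ∷ lk

  Linked-++⁻ˡ : ∀ P {B} → Linked R (P ++ B) → Linked R P
  Linked-++⁻ˡ []          _        = []
  Linked-++⁻ˡ (_ ∷ [])    _        = [-]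
  Linked-++⁻ˡ (_ ∷ y ∷ P) (r ∷ lk) = r ∷ Linked-++⁻ˡ (y ∷ P) lk

  Linked-++⁻ʳ : ∀ P {B} → Linked R (P ++ B) → Linked R B
  Linked-++⁻ʳ []      lk = lk
  Linked-++⁻ʳ (_ ∷ P) lk = Linked-++⁻ʳ P (Linked.tail lk)

  Linked-drop-mid : Transitive R → ∀ P {x B} → Linked R (P ++ x ∷ B) → Linked R (P ++ B)
  Linked-drop-mid trans []          lk                        = Linked.tail lk
  Linked-drop-mid trans (_ ∷ [])    {B = []}    _             = [-]
  Linked-drop-mid trans (_ ∷ [])    {B = _ ∷ _} (r ∷ r′ ∷ lk) = trans r r′ ∷ lk
  Linked-drop-mid trans (_ ∷ y ∷ P) (r ∷ lk)                  = r ∷ Linked-drop-mid trans (y ∷ P) lk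

  Linked-mono : ∀ {P : A → Set} {S : A → A → Set} → (∀ {x y} → P x → P y → R x y → S x y) →
                ∀ {l} → All P l → Linked R l → Linked S l
  Linked-mono h _              []       = []
  Linked-mono h _              [-]      = [-]
  Linked-mono h (px ∷ py ∷ ps) (r ∷ lk) = h px py r ∷ Linked-mono h (py ∷ ps) lk

merge-[]ʳ : ∀ xs → merge _>?_ xs [] ≡ xs
merge-[]ʳ []      = refl
merge-[]ʳ (_ ∷ _) = refl

merge-∷-∷ : ∀ {P : List ℕ → Set} x xs y ys →
            (y < x → P (x ∷ merge _>?_ xs (y ∷ ys))) → (x ≤ y → P (y ∷ merge _>?_ (x ∷ xs) ys)) →
            P (merge _>?_ (x ∷ xs) (y ∷ ys))
merge-∷-∷ x xs y ys left right with y <ᵇ x | <ᵇ-reflects-< y x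
... | true  | ofʸ y<x = left y<x
... | false | ofⁿ y≮x = right (≮⇒≥ y≮x)

merge-∷ˡ : ∀ x xs ys → All (_< x) ys → merge _>?_ (x ∷ xs) ys ≡ x ∷ merge _>?_ xs ys
merge-∷ˡ x xs []       _         = cong (x ∷_) (sym (merge-[]ʳ xs))
merge-∷ˡ x xs (y ∷ ys) (y<x ∷ _) = merge-∷-∷ {λ l → l ≡ x ∷ merge _>?_ xs (y ∷ ys)} x xs y ys
  (λ _ → refl) (λ x≤y → ⊥-elim (<⇒≱ y<x x≤y))

merge-∷ʳ : ∀ xs y ys → All (_< y) xs → merge _>?_ xs (y ∷ ys) ≡ y ∷ merge _>?_ xs ys
merge-∷ʳ []       y ys _         = refl
merge-∷ʳ (x ∷ xs) y ys (x<y ∷ _) = merge-∷-∷ {λ l → l ≡ y ∷ merge _>?_ (x ∷ xs) ys} x xs y ys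
  (λ y<x → ⊥-elim (<-asym x<y y<x)) (λ _ → refl)

All-merge : ∀ {P : ℕ → Set} {xs ys} → All P xs → All P ys → All P (merge _>?_ xs ys)
All-merge {xs = xs} {ys} pxs pys = All-resp-↭ (↭-sym (merge-↭ _>?_ xs ys)) (All.++⁺ pxs pys)

length-merge : ∀ xs ys → length (merge _>?_ xs ys) ≡ length xs + length ys
length-merge xs ys = trans (↭-length (merge-↭ _>?_ xs ys)) (length-++ xs)

isEven : ℕ → Bool
isEven zero          = true
isEven (suc zero)    = false
isEven (suc (suc n)) = isEven n

IsEven : ℕ → Set
IsEven x = isEven x ≡ true

IsOdd : ℕ → Set
IsOdd x = isEven x ≡ false

even? : ∀ x → Dec (IsEven x)
even? x = isEven x Bool.≟ true

odd? : ∀ x → Dec (IsOdd x)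
odd? x = isEven x Bool.≟ false

even⇒¬odd : ∀ {x} → IsEven x → ¬ IsOdd x
even⇒¬odd even odd with trans (sym even) odd
... | ()

odd⇒¬even : ∀ {x} → IsOdd x → ¬ IsEven x
odd⇒¬even {x} odd even = even⇒¬odd {x} even odd

parity-≢ : ∀ {x y} → IsEven x → IsOdd y → x ≢ y
parity-≢ {x} even odd refl = even⇒¬odd {x} even odd

isEven⊎isOdd : ∀ m → (IsEven m × Even m) ⊎ (IsOdd m × Odd m)
isEven⊎isOdd zero          = inj₁ (refl , refl)
isEven⊎isOdd (suc zero)    = inj₂ (refl , refl)
isEven⊎isOdd (suc (suc m)) with isEven⊎isOdd m
... | inj₁ (even , m%2) = inj₁ (even , trans (cong (_% 2) (+-comm 2 m)) (trans ([m+n]%n≡m%n m 2) m%2))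
... | inj₂ (odd  , m%2) = inj₂ (odd  , trans (cong (_% 2) (+-comm 2 m)) (trans ([m+n]%n≡m%n m 2) m%2))

IsEven⇒Even : ∀ m → IsEven m → Even m
IsEven⇒Even m even with isEven⊎isOdd m
... | inj₁ (_ , m%2≡0) = m%2≡0
... | inj₂ (odd , _)   = ⊥-elim (even⇒¬odd {m} even odd)

IsOdd⇒Odd : ∀ m → IsOdd m → Odd m
IsOdd⇒Odd m odd with isEven⊎isOdd m
... | inj₂ (_ , m%2≡1) = m%2≡1
... | inj₁ (even , _)  = ⊥-elim (even⇒¬odd {m} even odd)

Even⇒IsEven : ∀ m → Even m → IsEven m
Even⇒IsEven m m%2≡0 with isEven⊎isOdd m
... | inj₁ (even , _)  = even
... | inj₂ (_ , m%2≡1) with trans (sym m%2≡0) m%2≡1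
...   | ()

Odd⇒IsOdd : ∀ m → Odd m → IsOdd m
Odd⇒IsOdd m m%2≡1 with isEven⊎isOdd m
... | inj₂ (odd , _)   = odd
... | inj₁ (_ , m%2≡0) with trans (sym m%2≡0) m%2≡1
...   | ()

evens : List ℕ → List ℕ
evens = filter even?

odds : List ℕ → List ℕ
odds = filter odd?

-- Codes of weighted signed permutations

-- A letter xₖ of weight cₖ is stored as (cₖ , ∣xₖ∣): the sign of xₖ is fixed by the parity of cₖ.
Entry : Set
Entry = ℕ × ℕ

-- xₖ < xₖ₊₁ for two letters of the same weight, read off their absolute values.
AbsLt : Bool → ℕ → ℕ → Set
AbsLt true  a a′ = a < a′
AbsLt false a a′ = a′ < a

Precedes : Entry → Entry → Set
Precedes (c , a) (c′ , a′) = c′ ≤ c × (c ≡ c′ → AbsLt (isEven c) a a′)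

HeadWeight≤ : ℕ → List Entry → Set
HeadWeight≤ s []            = ⊤
HeadWeight≤ s ((c , _) ∷ _) = c ≤ s

range : ℕ → ℕ → List ℕ
range a zero    = []
range a (suc k) = suc a ∷ range (suc a) k

IsWSPCode : ℕ → ℕ → List Entry → Set
IsWSPCode n s u = Linked Precedes u × (map proj₂ u ↭ range 0 n) × HeadWeight≤ s u

-- Renumbering of the absolute values when the value q is created (shiftUp) or deleted (shiftDown).
shiftUp : ℕ → ℕ → ℕ
shiftUp q a with a <? q
... | yes _ = a
... | no  _ = suc a

shiftDown : ℕ → ℕ → ℕ
shiftDown q a with q <? a
... | yes _ = pred a
... | no  _ = a

shiftUpᵉ : ℕ → Entry → Entry
shiftUpᵉ q (c , a) = c , shiftUp q a

shiftDownᵉ : ℕ → Entry → Entry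
shiftDownᵉ q (c , a) = c , shiftDown q a

shiftUp-< : ∀ {q a} → a < q → shiftUp q a ≡ a
shiftUp-< {q} {a} a<q with a <? q
... | yes _   = refl
... | no  a≮q = ⊥-elim (a≮q a<q)

shiftUp-≥ : ∀ {q a} → q ≤ a → shiftUp q a ≡ suc a
shiftUp-≥ {q} {a} q≤a with a <? q
... | yes a<q = ⊥-elim (<⇒≱ a<q q≤a)
... | no  _   = refl

shiftUp-cases : ∀ q a → (a < q × shiftUp q a ≡ a) ⊎ (q ≤ a × shiftUp q a ≡ suc a)
shiftUp-cases q a with a <? q
... | yes a<q = inj₁ (a<q , refl)
... | no  a≮q = inj₂ (≮⇒≥ a≮q , refl)

shiftDown-≤ : ∀ {q a} → a ≤ q → shiftDown q a ≡ a
shiftDown-≤ {q} {a} a≤q with q <? a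
... | yes q<a = ⊥-elim (<⇒≱ q<a a≤q)
... | no  _   = refl

shiftDown-> : ∀ {q a} → q < a → shiftDown q a ≡ pred a
shiftDown-> {q} {a} q<a with q <? a
... | yes _   = refl
... | no  q≮a = ⊥-elim (q≮a q<a)

shiftDown-cases : ∀ q a → (a ≤ q × shiftDown q a ≡ a) ⊎ (q < a × shiftDown q a ≡ pred a)
shiftDown-cases q a with q <? a
... | yes q<a = inj₂ (q<a , refl)
... | no  q≮a = inj₁ (≮⇒≥ q≮a , refl)

shiftDown-shiftUp : ∀ q a → shiftDown q (shiftUp q a) ≡ a
shiftDown-shiftUp q a with a <? q
... | yes a<q = shiftDown-≤ (<⇒≤ a<q)
... | no  a≮q = shiftDown-> (s≤s (≮⇒≥ a≮q))

shiftUp-shiftDown : ∀ q a → a ≢ q → shiftUp q (shiftDown q a) ≡ a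
shiftUp-shiftDown q a a≢q with q <? a
shiftUp-shiftDown q (suc a) a≢q | yes (s≤s q≤a) = shiftUp-≥ q≤a
... | no q≮a = shiftUp-< (≤∧≢⇒< (≮⇒≥ q≮a) a≢q)

≤-shiftDown : ∀ {q a} → q < a → q ≤ shiftDown q a
≤-shiftDown {q} {suc a} (s≤s q≤a) = subst (q ≤_) (sym (shiftDown-> (s≤s q≤a))) q≤a

map-shiftDown-shiftUp : ∀ q l → map (shiftDownᵉ q) (map (shiftUpᵉ q) l) ≡ l
map-shiftDown-shiftUp q []            = refl
map-shiftDown-shiftUp q ((c , a) ∷ l) =
  cong₂ _∷_ (cong (c ,_) (shiftDown-shiftUp q a)) (map-shiftDown-shiftUp q l)

map-shiftUp-shiftDown : ∀ q l → All (_≢ q) (map proj₂ l) →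
                        map (shiftUpᵉ q) (map (shiftDownᵉ q) l) ≡ l
map-shiftUp-shiftDown q []            _          = refl
map-shiftUp-shiftDown q ((c , a) ∷ l) (a≢q ∷ ne) =
  cong₂ _∷_ (cong (c ,_) (shiftUp-shiftDown q a a≢q)) (map-shiftUp-shiftDown q l ne)

map-proj₂-shiftUpᵉ : ∀ q l → map proj₂ (map (shiftUpᵉ q) l) ≡ map (shiftUp q) (map proj₂ l)
map-proj₂-shiftUpᵉ q l = trans (sym (map-∘ l)) (map-∘ l)

map-proj₂-shiftDownᵉ : ∀ q l → map proj₂ (map (shiftDownᵉ q) l) ≡ map (shiftDown q) (map proj₂ l)
map-proj₂-shiftDownᵉ q l = trans (sym (map-∘ l)) (map-∘ l)

map-proj₁-shiftDownᵉ : ∀ q l → map proj₁ (map (shiftDownᵉ q) l) ≡ map proj₁ l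
map-proj₁-shiftDownᵉ q l = sym (map-∘ l)

∈-range : ∀ {x} a k → x ∈ range a k → a < x × x ≤ a + k
∈-range a (suc k) (here refl) = n<1+n a , subst (suc a ≤_) (sym (+-suc a k)) (s≤s (m≤m+n a k))
∈-range {x} a (suc k) (there x∈) with ∈-range (suc a) k x∈
... | a<x , x≤ = <-trans (n<1+n a) a<x , subst (x ≤_) (sym (+-suc a k)) x≤

range-++ : ∀ a k m → range a k ++ range (a + k) m ≡ range a (k + m)
range-++ a zero    m = cong (λ b → range b m) (+-identityʳ a)
range-++ a (suc k) m rewrite +-suc a k = cong (suc a ∷_) (range-++ (suc a) k m)

length-range : ∀ a k → length (range a k) ≡ k
length-range a zero    = refl
length-range a (suc k) = cong suc (length-range (suc a) k)

shiftDown-range-below : ∀ q a k → a + k ≤ q → map (shiftDown q) (range a k) ≡ range a k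
shiftDown-range-below q a zero    _ = refl
shiftDown-range-below q a (suc k) h rewrite +-suc a k =
  cong₂ _∷_ (shiftDown-≤ (≤-trans (s≤s (m≤m+n a k)) h)) (shiftDown-range-below q (suc a) k h)

shiftDown-range-above : ∀ q b m → q ≤ suc b → map (shiftDown q) (range (suc b) m) ≡ range b m
shiftDown-range-above q b zero    _ = refl
shiftDown-range-above q b (suc m) h =
  cong₂ _∷_ (shiftDown-> (s≤s h)) (shiftDown-range-above q (suc b) m (m≤n⇒m≤1+n h))

shiftUp-range-below : ∀ q a k → a + k < q → map (shiftUp q) (range a k) ≡ range a k
shiftUp-range-below q a zero    _ = refl
shiftUp-range-below q a (suc k) h rewrite +-suc a k =
  cong₂ _∷_ (shiftUp-< (≤-trans (s≤s (s≤s (m≤m+n a k))) h)) (shiftUp-range-below q (suc a) k h)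

shiftUp-range-above : ∀ q b m → q ≤ suc b → map (shiftUp q) (range b m) ≡ range (suc b) m
shiftUp-range-above q b zero    _ = refl
shiftUp-range-above q b (suc m) h =
  cong₂ _∷_ (shiftUp-≥ h) (shiftUp-range-above q (suc b) m (m≤n⇒m≤1+n h))

range-split : ∀ t m → range 0 (suc (t + m)) ≡ range 0 t ++ suc t ∷ range (suc t) m
range-split t m = sym (trans (range-++ 0 t (suc m)) (cong (range 0) (+-suc t m)))

↭-range-delete : ∀ q n A B → A ++ q ∷ B ↭ range 0 n →
                 map (shiftDown q) (A ++ B) ↭ range 0 (pred n) × All (_≢ q) (A ++ B)
↭-range-delete q n A B p with ∈-range 0 n (∈-resp-↭ p (∈-insert A))
↭-range-delete (suc t) n A B p | _ , t<n with m≤n⇒∃[o]m+o≡n t<n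
... | m , refl =
  subst (map (shiftDown (suc t)) (A ++ B) ↭_) shiftDown-rest (map⁺ (shiftDown (suc t)) p′) ,
  All-resp-↭ (↭-sym p′) (All.++⁺ (All.map below≢ (All.tabulate (∈-range 0 t)))
                                 (All.map above≢ (All.tabulate (∈-range (suc t) m))))
  where
  p′ : A ++ B ↭ range 0 t ++ range (suc t) m
  p′ = drop-mid A (range 0 t) (subst (A ++ suc t ∷ B ↭_) (range-split t m) p)
  shiftDown-rest : map (shiftDown (suc t)) (range 0 t ++ range (suc t) m) ≡ range 0 (t + m)
  shiftDown-rest = begin
    map (shiftDown (suc t)) (range 0 t ++ range (suc t) m)
      ≡⟨ map-++ (shiftDown (suc t)) (range 0 t) (range (suc t) m) ⟩
    map (shiftDown (suc t)) (range 0 t) ++ map (shiftDown (suc t)) (range (suc t) m)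
      ≡⟨ cong₂ _++_ (shiftDown-range-below (suc t) 0 t (n≤1+n t))
                    (shiftDown-range-above (suc t) t m ≤-refl) ⟩
    range 0 t ++ range t m
      ≡⟨ range-++ 0 t m ⟩
    range 0 (t + m) ∎
    where open ≡-Reasoning
  below≢ : ∀ {x} → 0 < x × x ≤ t → x ≢ suc t
  below≢ (_ , x≤t) refl = 1+n≰n x≤t
  above≢ : ∀ {x} → suc t < x × x ≤ suc t + m → x ≢ suc t
  above≢ (t<x , _) refl = <-irrefl refl t<x

↭-range-insert : ∀ n A B → A ++ B ↭ range 0 n →
                 let q = suc (length A) in
                 map (shiftUp q) A ++ q ∷ map (shiftUp q) B ↭ range 0 (suc n)
↭-range-insert n A B p = subst (map (shiftUp q) A ++ q ∷ map (shiftUp q) B ↭_) range-eq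
  (↭-trans (shift q (map (shiftUp q) A) (map (shiftUp q) B))
  (↭-trans (prep q shifted) (↭-sym (shift q (range 0 t) (range q m)))))
  where
  t = length A
  q = suc t
  m = n ∸ t
  t+m≡n : t + m ≡ n
  t+m≡n = m+[n∸m]≡n (subst (t ≤_) (trans (sym (length-++ A)) (trans (↭-length p) (length-range 0 n)))
                                     (m≤m+n t (length B)))
  range-eq : range 0 t ++ q ∷ range q m ≡ range 0 (suc n)
  range-eq = sym (trans (cong (λ k → range 0 (suc k)) (sym t+m≡n)) (range-split t m))
  p′ : A ++ B ↭ range 0 t ++ range t m
  p′ = subst (A ++ B ↭_) (trans (cong (range 0) (sym t+m≡n)) (sym (range-++ 0 t m))) p
  shifted : map (shiftUp q) A ++ map (shiftUp q) B ↭ range 0 t ++ range q m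
  shifted = subst₂ _↭_ (map-++ (shiftUp q) A B)
    (trans (map-++ (shiftUp q) (range 0 t) (range t m))
           (cong₂ _++_ (shiftUp-range-below q 0 t ≤-refl) (shiftUp-range-above q t m ≤-refl)))
    (map⁺ (shiftUp q) p′)

AbsLt-trans : ∀ b {x y z} → AbsLt b x y → AbsLt b y z → AbsLt b x z
AbsLt-trans true  x<y y<z = <-trans x<y y<z
AbsLt-trans false y<x z<y = <-trans z<y y<x

AbsLt-map : ∀ b (f : ℕ → ℕ) → (∀ {x y} → x < y → f x < f y) →
            ∀ {x y} → AbsLt b x y → AbsLt b (f x) (f y)
AbsLt-map true  f mono lt = mono lt
AbsLt-map false f mono lt = mono lt

Precedes-trans : ∀ {x y z} → Precedes x y → Precedes y z → Precedes x z
Precedes-trans {c₁ , a₁} {c₂ , _} {c₃ , a₃} (c₂≤c₁ , lt₁) (c₃≤c₂ , lt₂) =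
  ≤-trans c₃≤c₂ c₂≤c₁ , lt
  where
  lt : c₁ ≡ c₃ → AbsLt (isEven c₁) a₁ a₃
  lt refl with ≤-antisym c₂≤c₁ c₃≤c₂
  ... | refl = AbsLt-trans (isEven c₁) (lt₁ refl) (lt₂ refl)

shiftUp-mono : ∀ q {a b} → a < b → shiftUp q a < shiftUp q b
shiftUp-mono q {a} {b} a<b with shiftUp-cases q a | shiftUp-cases q b
... | inj₁ (_ , ea)   | inj₁ (_ , eb)   rewrite ea | eb = a<b
... | inj₁ (_ , ea)   | inj₂ (_ , eb)   rewrite ea | eb = m<n⇒m<1+n a<b
... | inj₂ (q≤a , _)  | inj₁ (b<q , _)  = ⊥-elim (<⇒≱ (<-trans a<b b<q) q≤a)
... | inj₂ (_ , ea)   | inj₂ (_ , eb)   rewrite ea | eb = s≤s a<b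

shiftDown-mono : ∀ q {a b} → a ≢ q → b ≢ q → a < b → shiftDown q a < shiftDown q b
shiftDown-mono q {a} {b} a≢q b≢q a<b with shiftDown-cases q a | shiftDown-cases q b
... | inj₁ (_ , ea)   | inj₁ (_ , eb)  rewrite ea | eb = a<b
shiftDown-mono q {a} {suc b} a≢q b≢q a<b | inj₁ (a≤q , ea) | inj₂ (s≤s q≤b , eb) rewrite ea | eb =
  ≤-trans (≤∧≢⇒< a≤q a≢q) q≤b
... | inj₂ (q<a , _)  | inj₁ (b≤q , _) = ⊥-elim (<⇒≱ (<-trans q<a a<b) b≤q)
shiftDown-mono q {suc a} {suc b} a≢q b≢q a<b | inj₂ (_ , ea) | inj₂ (_ , eb) rewrite ea | eb = ≤-pred a<b

Precedes-shiftUp : ∀ q {e e′} → Precedes e e′ → Precedes (shiftUpᵉ q e) (shiftUpᵉ q e′)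
Precedes-shiftUp q {c , _} (c′≤c , lt) =
  c′≤c , λ c≡c′ → AbsLt-map (isEven c) (shiftUp q) (shiftUp-mono q) (lt c≡c′)

Precedes-shiftDown : ∀ q {e e′} → proj₂ e ≢ q → proj₂ e′ ≢ q → Precedes e e′ →
                     Precedes (shiftDownᵉ q e) (shiftDownᵉ q e′)
Precedes-shiftDown q {c , a} {_ , a′} a≢q a′≢q (c′≤c , lt) =
  c′≤c , λ c≡c′ → shiftAbs (isEven c) (lt c≡c′)
  where
  shiftAbs : ∀ b → AbsLt b a a′ → AbsLt b (shiftDown q a) (shiftDown q a′)
  shiftAbs true  a<a′ = shiftDown-mono q a≢q a′≢q a<a′
  shiftAbs false a′<a = shiftDown-mono q a′≢q a≢q a′<a

fixedWeights : ℕ → List Entry → List ℕ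
fixedWeights p []            = []
fixedWeights p ((c , a) ∷ l) with a ≟ p
... | yes _ = c ∷ fixedWeights (suc p) l
... | no  _ = fixedWeights (suc p) l

firstFixed : ℕ → List Entry → Maybe (List Entry × Entry × List Entry)
firstFixed p []            = nothing
firstFixed p ((c , a) ∷ l) with a ≟ p
... | yes _ = just ([] , (c , a) , l)
... | no  _ = Maybe.map (map₁ ((c , a) ∷_)) (firstFixed (suc p) l)

fixedWeights-fixed : ∀ p c a l → a ≡ p → fixedWeights p ((c , a) ∷ l) ≡ c ∷ fixedWeights (suc p) l
fixedWeights-fixed p c a l a≡p with a ≟ p
... | yes _   = refl
... | no  a≢p = ⊥-elim (a≢p a≡p)

fixedWeights-unfixed : ∀ p c a l → a ≢ p → fixedWeights p ((c , a) ∷ l) ≡ fixedWeights (suc p) l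
fixedWeights-unfixed p c a l a≢p with a ≟ p
... | yes a≡p = ⊥-elim (a≢p a≡p)
... | no  _   = refl

fixedWeights-∷≡[] : ∀ p c a l → fixedWeights p ((c , a) ∷ l) ≡ [] →
                    a ≢ p × fixedWeights (suc p) l ≡ []
fixedWeights-∷≡[] p c a l none with a ≟ p
fixedWeights-∷≡[] p c a l () | yes _
... | no a≢p = a≢p , none

fixedWeights-++ : ∀ p A B →
                  fixedWeights p (A ++ B) ≡ fixedWeights p A ++ fixedWeights (p + length A) B
fixedWeights-++ p []            B = cong (λ r → fixedWeights r B) (sym (+-identityʳ p))
fixedWeights-++ p ((c , a) ∷ A) B rewrite +-suc p (length A) with a ≟ p
... | yes _ = cong (c ∷_) (fixedWeights-++ (suc p) A B)
... | no  _ = fixedWeights-++ (suc p) A B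

fixedWeights≡[]⇒firstFixed≡nothing : ∀ p l → fixedWeights p l ≡ [] → firstFixed p l ≡ nothing
fixedWeights≡[]⇒firstFixed≡nothing p []            _    = refl
fixedWeights≡[]⇒firstFixed≡nothing p ((c , a) ∷ l) none with a ≟ p
fixedWeights≡[]⇒firstFixed≡nothing p ((c , a) ∷ l) () | yes _
... | no _ rewrite fixedWeights≡[]⇒firstFixed≡nothing (suc p) l none = refl

firstFixed≡nothing⇒fixedWeights≡[] : ∀ p l → firstFixed p l ≡ nothing → fixedWeights p l ≡ []
firstFixed≡nothing⇒fixedWeights≡[] p []            _ = refl
firstFixed≡nothing⇒fixedWeights≡[] p ((c , a) ∷ l) eq with a ≟ p
firstFixed≡nothing⇒fixedWeights≡[] p ((c , a) ∷ l) () | yes _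
... | no _ with firstFixed (suc p) l in eq′
...   | nothing = firstFixed≡nothing⇒fixedWeights≡[] (suc p) l eq′

record FirstFixed (p : ℕ) (l pre : List Entry) (e : Entry) (post : List Entry) : Set where
  field
    split      : l ≡ pre ++ e ∷ post
    position   : proj₂ e ≡ p + length pre
    noneBefore : fixedWeights p pre ≡ []

firstFixed≡just : ∀ p l {pre e post} → firstFixed p l ≡ just (pre , e , post) →
                  FirstFixed p l pre e post
firstFixed≡just p ((c , a) ∷ l) eq with a ≟ p
firstFixed≡just p ((c , a) ∷ l) refl | yes a≡p =
  record { split = refl ; position = trans a≡p (sym (+-identityʳ p)) ; noneBefore = refl }
... | no a≢p with firstFixed (suc p) l in eq′
firstFixed≡just p ((c , a) ∷ l) refl | no a≢p | just (pre , e , post) = record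
  { split      = cong ((c , a) ∷_) (FirstFixed.split ih)
  ; position   = trans (FirstFixed.position ih) (sym (+-suc p (length pre)))
  ; noneBefore = trans (fixedWeights-unfixed p c a pre a≢p) (FirstFixed.noneBefore ih)
  }
  where ih = firstFixed≡just (suc p) l eq′

firstFixed-intro : ∀ p pre c a post → a ≡ p + length pre → fixedWeights p pre ≡ [] →
                   firstFixed p (pre ++ (c , a) ∷ post) ≡ just (pre , (c , a) , post)
firstFixed-intro p [] c a post a≡p _ with a ≟ p
... | yes _   = refl
... | no  a≢p = ⊥-elim (a≢p (trans a≡p (+-identityʳ p)))
firstFixed-intro p ((c′ , a′) ∷ pre) c a post a≡ none with a′ ≟ p
firstFixed-intro p ((c′ , a′) ∷ pre) c a post a≡ () | yes _
... | no _ rewrite firstFixed-intro (suc p) pre c a post (trans a≡ (+-suc p (length pre))) none = refl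

fixedWeights-∷-cong : ∀ {p p′ c a a′ X Y} → (a′ ≡ p′ → a ≡ p) → (a ≡ p → a′ ≡ p′) →
                      fixedWeights (suc p′) X ≡ fixedWeights (suc p) Y →
                      fixedWeights p′ ((c , a′) ∷ X) ≡ fixedWeights p ((c , a) ∷ Y)
fixedWeights-∷-cong {p} {p′} {c} {a} {a′} to from tails with a′ ≟ p′ | a ≟ p
... | yes _   | yes _   = cong (c ∷_) tails
... | yes a′≡ | no  a≢  = ⊥-elim (a≢ (to a′≡))
... | no  a′≢ | yes a≡  = ⊥-elim (a′≢ (from a≡))
... | no  _   | no  _   = tails

shiftUp≡-below : ∀ {q a r} → r < q → shiftUp q a ≡ r → a ≡ r
shiftUp≡-below {q} {a} r<q eq with shiftUp-cases q a
... | inj₁ (_ , up≡a) = trans (sym up≡a) eq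
... | inj₂ (q≤a , up≡1+a) =
  ⊥-elim (<⇒≱ (<-trans (n<1+n a) (subst (_< q) (sym (trans (sym up≡1+a) eq)) r<q)) q≤a)

shiftUp≡-above : ∀ {q a r} → q ≤ r → shiftUp q a ≡ suc r → a ≡ r
shiftUp≡-above {q} {a} q≤r eq with shiftUp-cases q a
... | inj₁ (a<q , up≡a) =
  ⊥-elim (<⇒≱ (<-trans a<q (s≤s q≤r)) (≤-reflexive (trans (sym eq) up≡a)))
... | inj₂ (_ , up≡1+a) = suc-injective (trans (sym up≡1+a) eq)

fixedWeights-shiftUp-below : ∀ q p A → p + length A ≤ q →
                             fixedWeights p (map (shiftUpᵉ q) A) ≡ fixedWeights p A
fixedWeights-shiftUp-below q p []      _ = refl
fixedWeights-shiftUp-below q p (_ ∷ A) h rewrite +-suc p (length A) =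
  fixedWeights-∷-cong (shiftUp≡-below p<q) (λ { refl → shiftUp-< p<q })
                      (fixedWeights-shiftUp-below q (suc p) A h)
  where p<q = ≤-trans (s≤s (m≤m+n p (length A))) h

fixedWeights-shiftUp-above : ∀ q p B → q ≤ p →
                             fixedWeights (suc p) (map (shiftUpᵉ q) B) ≡ fixedWeights p B
fixedWeights-shiftUp-above q p []      _   = refl
fixedWeights-shiftUp-above q p (_ ∷ B) q≤p =
  fixedWeights-∷-cong (shiftUp≡-above q≤p) (λ { refl → shiftUp-≥ q≤p })
                      (fixedWeights-shiftUp-above q (suc p) B (m≤n⇒m≤1+n q≤p))

fixedWeights-shiftDown-below : ∀ q p A → All (_≢ q) (map proj₂ A) → p + length A ≤ q →
                               fixedWeights p (map (shiftDownᵉ q) A) ≡ fixedWeights p A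
fixedWeights-shiftDown-below q p A ne h =
  trans (sym (fixedWeights-shiftUp-below q p (map (shiftDownᵉ q) A)
                                          (subst (λ k → p + k ≤ q) (sym (length-map _ A)) h)))
        (cong (fixedWeights p) (map-shiftUp-shiftDown q A ne))

fixedWeights-shiftDown-above : ∀ q p B → All (_≢ q) (map proj₂ B) → q ≤ p →
                               fixedWeights p (map (shiftDownᵉ q) B) ≡ fixedWeights (suc p) B
fixedWeights-shiftDown-above q p B ne q≤p =
  trans (sym (fixedWeights-shiftUp-above q p (map (shiftDownᵉ q) B) q≤p))
        (cong (fixedWeights (suc p)) (map-shiftUp-shiftDown q B ne))

-- Inserting and deleting a fixed point

-- AbsLt b p (shiftUp p a), i.e. where a new value p sits among the old ones after renumbering.
BeforeValue : Bool → ℕ → ℕ → Set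
BeforeValue true  p a = p ≤ a
BeforeValue false p a = a < p

beforeValue? : ∀ b p a → Dec (BeforeValue b p a)
beforeValue? true  p a = p ≤? a
beforeValue? false p a = a <? p

-- A new fixed point of weight v at position p must come before the entry e at position p.
InsertBefore : ℕ → ℕ → Entry → Set
InsertBefore v p (c , a) = c < v ⊎ (c ≡ v × BeforeValue (isEven v) p a)

insertBefore? : ∀ v p e → Dec (InsertBefore v p e)
insertBefore? v p (c , a) = (c <? v) ⊎-dec ((c ≟ v) ×-dec beforeValue? (isEven v) p a)

splitForInsert : ℕ → ℕ → List Entry → List Entry × List Entry
splitForInsert v p []      = [] , []
splitForInsert v p (e ∷ l) with insertBefore? v p e
... | yes _ = [] , e ∷ l
... | no  _ = map₁ (e ∷_) (splitForInsert v (suc p) l)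

insertAt : ℕ → List Entry → List Entry → List Entry
insertAt v pre post = map (shiftUpᵉ q) pre ++ (v , q) ∷ map (shiftUpᵉ q) post
  where q = suc (length pre)

insertFixed : ℕ → List Entry → List Entry
insertFixed v u = insertAt v (proj₁ (splitForInsert v 1 u)) (proj₂ (splitForInsert v 1 u))

removeFixed : ℕ → List Entry → List Entry → List Entry
removeFixed q pre post = map (shiftDownᵉ q) (pre ++ post)

-- The first argument only bounds the number of fixed points removed; the length of the list suffices.
decompose : ℕ → List Entry → List Entry × List ℕ
decompose zero    u = u , []
decompose (suc k) u with firstFixed 1 u
... | nothing                    = u , []
... | just (pre , (v , q) , post) = map₂ (v ∷_) (decompose k (removeFixed q pre post))

rebuild : List Entry → List ℕ → List Entry
rebuild D []      = D
rebuild D (v ∷ z) = insertFixed v (rebuild D z)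

NoInsertBefore : ℕ → ℕ → List Entry → Set
NoInsertBefore v p []      = ⊤
NoInsertBefore v p (e ∷ A) = ¬ InsertBefore v p e × NoInsertBefore v (suc p) A

InsertBeforeHead : ℕ → ℕ → List Entry → Set
InsertBeforeHead v p []      = ⊤
InsertBeforeHead v p (e ∷ _) = InsertBefore v p e

splitForInsert-++ : ∀ v p u → proj₁ (splitForInsert v p u) ++ proj₂ (splitForInsert v p u) ≡ u
splitForInsert-++ v p []      = refl
splitForInsert-++ v p (e ∷ u) with insertBefore? v p e
... | yes _ = refl
... | no  _ = cong (e ∷_) (splitForInsert-++ v (suc p) u)

splitForInsert-noInsert : ∀ v p u → NoInsertBefore v p (proj₁ (splitForInsert v p u))
splitForInsert-noInsert v p []      = tt
splitForInsert-noInsert v p (e ∷ u) with insertBefore? v p e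
... | yes _ = tt
... | no  ¬ins = ¬ins , splitForInsert-noInsert v (suc p) u

splitForInsert-insert : ∀ v p u →
  InsertBeforeHead v (p + length (proj₁ (splitForInsert v p u))) (proj₂ (splitForInsert v p u))
splitForInsert-insert v p []      = tt
splitForInsert-insert v p (e ∷ u) with insertBefore? v p e
... | yes ins = subst (λ r → InsertBefore v r e) (sym (+-identityʳ p)) ins
... | no  _   = subst (λ r → InsertBeforeHead v r (proj₂ (splitForInsert v (suc p) u)))
                      (sym (+-suc p _)) (splitForInsert-insert v (suc p) u)

splitForInsert-unique : ∀ v p A B → NoInsertBefore v p A → InsertBeforeHead v (p + length A) B →
                        splitForInsert v p (A ++ B) ≡ (A , B)
splitForInsert-unique v p []      []      _           _   = refl
splitForInsert-unique v p []      (e ∷ B) _           ins with insertBefore? v p e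
... | yes _    = refl
... | no  ¬ins = ⊥-elim (¬ins (subst (λ r → InsertBefore v r e) (+-identityʳ p) ins))
splitForInsert-unique v p (e ∷ A) B (¬ins , noA) ins with insertBefore? v p e
... | yes insE = ⊥-elim (¬ins insE)
... | no  _ rewrite +-suc p (length A) | splitForInsert-unique v (suc p) A B noA ins = refl

-- Constraint on an entry at position p in front of the first fixed point (v , q).
-- In the even case the increasing values a < ⋯ < q at positions p < ⋯ < q force a ≤ p, and a ≠ p.
BeforeFixedValue : Bool → ℕ → ℕ → ℕ → Set
BeforeFixedValue true  q p a = a < p
BeforeFixedValue false q p a = q < a

BeforeFirstFixed : ℕ → ℕ → ℕ → Entry → Set
BeforeFirstFixed v q p (c , a) = v ≤ c × (c ≡ v → BeforeFixedValue (isEven v) q p a)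

AllBeforeFirstFixed : ℕ → ℕ → ℕ → List Entry → Set
AllBeforeFirstFixed v q p []      = ⊤
AllBeforeFirstFixed v q p (e ∷ l) = BeforeFirstFixed v q p e × AllBeforeFirstFixed v q (suc p) l

allBeforeFirstFixed : ∀ v q post p pre → Linked Precedes (pre ++ (v , q) ∷ post) →
                      fixedWeights p pre ≡ [] → q ≡ p + length pre → AllBeforeFirstFixed v q p pre
allBeforeFirstFixed v q post p []                          _        _    _  = tt
allBeforeFirstFixed v q post p ((c , a) ∷ [])              (r ∷ _)  none q≡ = (proj₁ r , bound) , tt
  where
  bound : c ≡ v → BeforeFixedValue (isEven v) q p a
  bound refl with isEven c | proj₂ r refl
  ... | true  | a<q = ≤∧≢⇒< (≤-pred (subst (a <_) (trans q≡ (+-comm p 1)) a<q))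
                            (proj₁ (fixedWeights-∷≡[] p c a [] none))
  ... | false | q<a = q<a
allBeforeFirstFixed v q post p ((c , a) ∷ (c′ , a′) ∷ pre) (r ∷ lk) none q≡ =
  (≤-trans (proj₁ next) (proj₁ r) , bound) , rest
  where
  rest = allBeforeFirstFixed v q post (suc p) ((c′ , a′) ∷ pre) lk
           (proj₂ (fixedWeights-∷≡[] p c a _ none)) (trans q≡ (+-suc p _))
  next = proj₁ rest
  bound : c ≡ v → BeforeFixedValue (isEven v) q p a
  bound refl with ≤-antisym (proj₁ r) (proj₁ next)
  ... | refl with isEven c | proj₂ r refl | proj₂ next refl
  ...   | true  | a<a′ | a′<1+p = ≤-trans a<a′ (≤-pred a′<1+p)
  ...   | false | a′<a | q<a′   = <-trans q<a′ a′<a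

noInsertBefore-shiftDown : ∀ v q p pre → AllBeforeFirstFixed v q p pre → All (_≢ q) (map proj₂ pre) →
                           p + length pre ≤ q → NoInsertBefore v p (map (shiftDownᵉ q) pre)
noInsertBefore-shiftDown v q p []              _                    _        _     = tt
noInsertBefore-shiftDown v q p ((c , a) ∷ pre) ((v≤c , bound) , bs) (_ ∷ ne) p+l≤q
  rewrite +-suc p (length pre) =
  ¬ins , noInsertBefore-shiftDown v q (suc p) pre bs ne p+l≤q
  where
  p<q : p < q
  p<q = ≤-trans (s≤s (m≤m+n p (length pre))) p+l≤q
  ¬ins : ¬ InsertBefore v p (c , shiftDown q a)
  ¬ins (inj₁ c<v)         = <⇒≱ c<v v≤c
  ¬ins (inj₂ (refl , at)) with isEven c | bound refl
  ... | true  | a<p = <⇒≱ a<p (subst (p ≤_) (shiftDown-≤ (<⇒≤ (<-trans a<p p<q))) at)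
  ... | false | q<a = <⇒≱ (<-trans at p<q) (≤-shiftDown q<a)

insertBeforeHead-shiftDown : ∀ v q post → Linked Precedes ((v , q) ∷ post) →
                             InsertBeforeHead v q (map (shiftDownᵉ q) post)
insertBeforeHead-shiftDown v q []               _       = tt
insertBeforeHead-shiftDown v q ((c , a) ∷ post) (r ∷ _) with c <? v
... | yes c<v = inj₁ c<v
... | no  c≮v with ≤-antisym (proj₁ r) (≮⇒≥ c≮v)
...   | refl = inj₂ (refl , before (isEven c) (proj₂ r refl))
  where
  before : ∀ b → AbsLt b q a → BeforeValue b q (shiftDown q a)
  before true  q<a = ≤-shiftDown q<a
  before false a<q = subst (_< q) (sym (shiftDown-≤ (<⇒≤ a<q))) a<q

insertAt-shiftDown : ∀ v q pre post → q ≡ suc (length pre) →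
                     All (_≢ q) (map proj₂ pre ++ map proj₂ post) →
                     insertAt v (map (shiftDownᵉ q) pre) (map (shiftDownᵉ q) post) ≡ pre ++ (v , q) ∷ post
insertAt-shiftDown v q pre post q≡ ne rewrite length-map (shiftDownᵉ q) pre | sym q≡ =
  cong₂ _++_ (map-shiftUp-shiftDown q pre (All.++⁻ˡ (map proj₂ pre) ne))
             (cong ((v , q) ∷_) (map-shiftUp-shiftDown q post (All.++⁻ʳ (map proj₂ pre) ne)))

insertFixed-removeFixed : ∀ v q pre post → Linked Precedes (pre ++ (v , q) ∷ post) →
                          fixedWeights 1 pre ≡ [] → q ≡ suc (length pre) →
                          All (_≢ q) (map proj₂ pre ++ map proj₂ post) →
                          insertFixed v (removeFixed q pre post) ≡ pre ++ (v , q) ∷ post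
insertFixed-removeFixed v q pre post lk none q≡ ne = begin
  insertFixed v (removeFixed q pre post)
    ≡⟨ cong (λ s → insertAt v (proj₁ s) (proj₂ s)) split≡ ⟩
  insertAt v (map (shiftDownᵉ q) pre) (map (shiftDownᵉ q) post)
    ≡⟨ insertAt-shiftDown v q pre post q≡ ne ⟩
  pre ++ (v , q) ∷ post ∎
  where
  open ≡-Reasoning
  noInsert : NoInsertBefore v 1 (map (shiftDownᵉ q) pre)
  noInsert = noInsertBefore-shiftDown v q 1 pre (allBeforeFirstFixed v q post 1 pre lk none q≡)
                                      (All.++⁻ˡ (map proj₂ pre) ne) (≤-reflexive (sym q≡))
  insertHead : InsertBeforeHead v (1 + length (map (shiftDownᵉ q) pre)) (map (shiftDownᵉ q) post)
  insertHead = subst (λ r → InsertBeforeHead v r (map (shiftDownᵉ q) post))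
                     (trans q≡ (cong suc (sym (length-map (shiftDownᵉ q) pre))))
                     (insertBeforeHead-shiftDown v q post (Linked-++⁻ʳ pre lk))
  split≡ : splitForInsert v 1 (removeFixed q pre post) ≡
           (map (shiftDownᵉ q) pre , map (shiftDownᵉ q) post)
  split≡ = trans (cong (splitForInsert v 1) (map-++ (shiftDownᵉ q) pre post))
                 (splitForInsert-unique v 1 _ _ noInsert insertHead)

weights-removeFixed : ∀ v q pre post →
                      map proj₁ (pre ++ (v , q) ∷ post) ↭ v ∷ map proj₁ (removeFixed q pre post)
weights-removeFixed v q pre post =
  subst₂ _↭_ (sym (map-++ proj₁ pre ((v , q) ∷ post)))
             (cong (v ∷_) (sym (trans (map-proj₁-shiftDownᵉ q (pre ++ post)) (map-++ proj₁ pre post))))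
             (shift v (map proj₁ pre) (map proj₁ post))

fixedWeights-removeFixed : ∀ v q pre post → fixedWeights 1 pre ≡ [] → q ≡ suc (length pre) →
                           All (_≢ q) (map proj₂ pre ++ map proj₂ post) →
                           fixedWeights 1 (pre ++ (v , q) ∷ post) ≡
                           v ∷ fixedWeights 1 (removeFixed q pre post)
fixedWeights-removeFixed v q pre post none refl ne = begin
  fixedWeights 1 (pre ++ (v , q) ∷ post)
    ≡⟨ fixedWeights-++ 1 pre ((v , q) ∷ post) ⟩
  fixedWeights 1 pre ++ fixedWeights q ((v , q) ∷ post)
    ≡⟨ cong₂ _++_ none (fixedWeights-fixed q v q post refl) ⟩
  v ∷ fixedWeights (suc q) post
    ≡⟨ cong (v ∷_) (sym (fixedWeights-shiftDown-above q q post (All.++⁻ʳ (map proj₂ pre) ne) ≤-refl)) ⟩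
  v ∷ fixedWeights q post′
    ≡⟨ cong (λ r → v ∷ fixedWeights (suc r) post′) (sym (length-map _ pre)) ⟩
  v ∷ fixedWeights (1 + length pre′) post′
    ≡⟨ cong (λ l → v ∷ l ++ fixedWeights (1 + length pre′) post′)
            (sym (trans (fixedWeights-shiftDown-below q 1 pre (All.++⁻ˡ (map proj₂ pre) ne) ≤-refl) none)) ⟩
  v ∷ fixedWeights 1 pre′ ++ fixedWeights (1 + length pre′) post′
    ≡⟨ cong (v ∷_) (sym (fixedWeights-++ 1 pre′ post′)) ⟩
  v ∷ fixedWeights 1 (pre′ ++ post′)
    ≡⟨ cong (λ l → v ∷ fixedWeights 1 l) (sym (map-++ (shiftDownᵉ q) pre post)) ⟩
  v ∷ fixedWeights 1 (removeFixed q pre post) ∎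
  where
  open ≡-Reasoning
  pre′  = map (shiftDownᵉ (suc (length pre))) pre
  post′ = map (shiftDownᵉ (suc (length pre))) post

IsWSPCode-removeFixed : ∀ k s v q pre post → IsWSPCode (suc k) s (pre ++ (v , q) ∷ post) →
                        IsWSPCode k s (removeFixed q pre post) ×
                        All (_≢ q) (map proj₂ pre ++ map proj₂ post)
IsWSPCode-removeFixed k s v q pre post (lk , perm , hd) = (linked , perm′ , head pre lk hd) , ne
  where
  deleted = ↭-range-delete q (suc k) (map proj₂ pre) (map proj₂ post)
              (subst (_↭ range 0 (suc k)) (map-++ proj₂ pre ((v , q) ∷ post)) perm)
  ne = proj₂ deleted
  perm′ : map proj₂ (removeFixed q pre post) ↭ range 0 k
  perm′ = subst (_↭ range 0 k)
                (sym (trans (map-proj₂-shiftDownᵉ q (pre ++ post))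
                            (cong (map (shiftDown q)) (map-++ proj₂ pre post))))
                (proj₁ deleted)
  linked : Linked Precedes (removeFixed q pre post)
  linked = Linked.map⁺ (Linked-mono (Precedes-shiftDown q)
             (All.map⁻ (subst (All (_≢ q)) (sym (map-++ proj₂ pre post)) ne))
             (Linked-drop-mid Precedes-trans pre lk))
  head : ∀ pre → Linked Precedes (pre ++ (v , q) ∷ post) → HeadWeight≤ s (pre ++ (v , q) ∷ post) →
         HeadWeight≤ s (removeFixed q pre post)
  head (_ ∷ _) _       hd = hd
  head []      (r ∷ _) hd = ≤-trans (proj₁ r) hd
  head []      [-]     _  = tt

-- Consecutive weights of fixed points, read left to right: nonincreasing, no odd weight repeated.
FixedStep : ℕ → ℕ → Set
FixedStep v c = c ≤ v × (IsOdd v → c ≢ v)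

FixedStep-trans : ∀ {a b c} → FixedStep a b → FixedStep b c → FixedStep a c
FixedStep-trans (b≤a , odd-b≢a) (c≤b , _) =
  ≤-trans c≤b b≤a , λ odd c≡a → odd-b≢a odd (≤-antisym b≤a (subst (_≤ _) c≡a c≤b))

fixedWeights-noInsert : ∀ v p pre → NoInsertBefore v p pre → All (FixedStep v) (fixedWeights p pre) →
                        fixedWeights p pre ≡ []
fixedWeights-noInsert v p []              _              _     = refl
fixedWeights-noInsert v p ((c , a) ∷ pre) (¬ins , noIns) steps with a ≟ p
... | no  _    = fixedWeights-noInsert v (suc p) pre noIns steps
fixedWeights-noInsert v p ((c , a) ∷ pre) (¬ins , noIns) ((c≤v , odd-c≢v) ∷ _) | yes refl =
  ⊥-elim (byParity (isEven v) refl)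
  where
  c≡v : c ≡ v
  c≡v = ≤-antisym c≤v (≮⇒≥ (¬ins ∘ inj₁))
  byParity : ∀ b → isEven v ≡ b → ⊥
  byParity true  even = ¬ins (inj₂ (c≡v , subst (λ b → BeforeValue b a a) (sym even) ≤-refl))
  byParity false odd  = odd-c≢v odd c≡v

last-Precedes-insert : ∀ v q p pre → NoInsertBefore v p pre → fixedWeights p pre ≡ [] →
                       p + length pre ≡ q → Connected Precedes (last (map (shiftUpᵉ q) pre)) (just (v , q))
last-Precedes-insert v q p []             _          _    _     = nothing-just
last-Precedes-insert v q p ((c , a) ∷ []) (¬ins , _) none p+1≡q = just (≮⇒≥ (¬ins ∘ inj₁) , precedes)
  where
  q≡ : q ≡ suc p
  q≡ = trans (sym p+1≡q) (+-comm p 1)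
  precedes : c ≡ v → AbsLt (isEven c) (shiftUp q a) q
  precedes refl = byParity (isEven c) refl
    where
    byParity : ∀ b → isEven c ≡ b → AbsLt b (shiftUp q a) q
    byParity true even = subst (_< q) (sym (shiftUp-< a<q)) a<q
      where
      a<q = <-trans (≰⇒> λ p≤a → ¬ins (inj₂ (refl , subst (λ b → BeforeValue b p a) (sym even) p≤a)))
                    (subst (p <_) (sym q≡) ≤-refl)
    byParity false odd = subst (q <_) (sym (shiftUp-≥ q≤a)) (s≤s q≤a)
      where
      p≤a = ≮⇒≥ λ a<p → ¬ins (inj₂ (refl , subst (λ b → BeforeValue b p a) (sym odd) a<p))
      q≤a = subst (_≤ a) (sym q≡) (≤∧≢⇒< p≤a (proj₁ (fixedWeights-∷≡[] p c a [] none) ∘ sym))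
last-Precedes-insert v q p ((c , a) ∷ e ∷ pre) (_ , noIns) none p+l≡q =
  last-Precedes-insert v q (suc p) (e ∷ pre) noIns (proj₂ (fixedWeights-∷≡[] p c a _ none))
                       (trans (sym (+-suc p (length (e ∷ pre)))) p+l≡q)

Linked-insert-head : ∀ v q post → InsertBeforeHead v q post → Linked Precedes post →
                     Linked Precedes ((v , q) ∷ map (shiftUpᵉ q) post)
Linked-insert-head v q []               _   _  = [-]
Linked-insert-head v q ((c , a) ∷ post) ins lk =
  precedes ins ∷ Linked.map⁺ (Linked.map (Precedes-shiftUp q) lk)
  where
  precedes : InsertBefore v q (c , a) → Precedes (v , q) (c , shiftUp q a)
  precedes (inj₁ c<v)         = <⇒≤ c<v , λ v≡c → ⊥-elim (<-irrefl (sym v≡c) c<v)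
  precedes (inj₂ (refl , at)) = ≤-refl , λ _ → before (isEven c) at
    where
    before : ∀ b → BeforeValue b q a → AbsLt b q (shiftUp q a)
    before true  q≤a = subst (q <_) (sym (shiftUp-≥ q≤a)) (s≤s q≤a)
    before false a<q = subst (_< q) (sym (shiftUp-< a<q)) a<q

noFixedBeforeInsert : ∀ v u → All (FixedStep v) (fixedWeights 1 u) →
                      fixedWeights 1 (proj₁ (splitForInsert v 1 u)) ≡ []
noFixedBeforeInsert v u steps =
  fixedWeights-noInsert v 1 pre (splitForInsert-noInsert v 1 u) (All.++⁻ˡ (fixedWeights 1 pre) steps′)
  where
  pre  = proj₁ (splitForInsert v 1 u)
  post = proj₂ (splitForInsert v 1 u)
  steps′ : All (FixedStep v) (fixedWeights 1 pre ++ fixedWeights (1 + length pre) post)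
  steps′ = subst (All (FixedStep v))
                 (trans (cong (fixedWeights 1) (sym (splitForInsert-++ v 1 u))) (fixedWeights-++ 1 pre post))
                 steps

decompose-insertAt : ∀ v pre post k → fixedWeights 1 pre ≡ [] →
                     decompose (suc k) (insertAt v pre post) ≡ map₂ (v ∷_) (decompose k (pre ++ post))
decompose-insertAt v pre post k none
  rewrite firstFixed-intro 1 (map (shiftUpᵉ (suc (length pre))) pre) v (suc (length pre))
                           (map (shiftUpᵉ (suc (length pre))) post) (cong suc (sym (length-map _ pre)))
                           (trans (fixedWeights-shiftUp-below _ 1 pre ≤-refl) none)
        | sym (map-++ (shiftUpᵉ (suc (length pre))) pre post)
        | map-shiftDown-shiftUp (suc (length pre)) (pre ++ post) = refl

decompose-insertFixed : ∀ v u k → All (FixedStep v) (fixedWeights 1 u) →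
                        decompose (suc k) (insertFixed v u) ≡ map₂ (v ∷_) (decompose k u)
decompose-insertFixed v u k steps =
  trans (decompose-insertAt v _ _ k (noFixedBeforeInsert v u steps))
        (cong (λ l → map₂ (v ∷_) (decompose k l)) (splitForInsert-++ v 1 u))

IsWSPCode-insertFixed : ∀ n s v u → IsWSPCode n s u → v ≤ s → All (FixedStep v) (fixedWeights 1 u) →
                        IsWSPCode (suc n) s (insertFixed v u)
IsWSPCode-insertFixed n s v u (lk , perm , hd) v≤s steps = linked , perm′ , head pre refl
  where
  pre  = proj₁ (splitForInsert v 1 u)
  post = proj₂ (splitForInsert v 1 u)
  q    = suc (length pre)
  u≡ : pre ++ post ≡ u
  u≡ = splitForInsert-++ v 1 u
  lk′ : Linked Precedes (pre ++ post)
  lk′ = subst (Linked Precedes) (sym u≡) lk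
  linked : Linked Precedes (insertFixed v u)
  linked = Linked.++⁺
    (Linked.map⁺ (Linked.map (Precedes-shiftUp q) (Linked-++⁻ˡ pre lk′)))
    (last-Precedes-insert v q 1 pre (splitForInsert-noInsert v 1 u) (noFixedBeforeInsert v u steps) refl)
    (Linked-insert-head v q post (splitForInsert-insert v 1 u) (Linked-++⁻ʳ pre lk′))
  perm′ : map proj₂ (insertFixed v u) ↭ range 0 (suc n)
  perm′ = subst (_↭ range 0 (suc n)) (sym values≡)
            (↭-range-insert n (map proj₂ pre) (map proj₂ post)
               (subst (_↭ range 0 n) (trans (cong (map proj₂) (sym u≡)) (map-++ proj₂ pre post)) perm))
    where
    values≡ : map proj₂ (insertFixed v u) ≡
              map (shiftUp (suc (length (map proj₂ pre)))) (map proj₂ pre) ++ suc (length (map proj₂ pre))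
                ∷ map (shiftUp (suc (length (map proj₂ pre)))) (map proj₂ post)
    values≡ rewrite length-map proj₂ pre =
      trans (map-++ proj₂ (map (shiftUpᵉ q) pre) ((v , q) ∷ map (shiftUpᵉ q) post))
            (cong₂ _++_ (map-proj₂-shiftUpᵉ q pre) (cong (q ∷_) (map-proj₂-shiftUpᵉ q post)))
  head : ∀ P → P ≡ pre → HeadWeight≤ s (map (shiftUpᵉ q) P ++ (v , q) ∷ map (shiftUpᵉ q) post)
  head []      _    = v≤s
  head (_ ∷ P) P≡ = subst (HeadWeight≤ s) (sym (trans (cong (_++ post) P≡) u≡)) hd

-- Decomposition

length-IsWSPCode : ∀ {n s u} → IsWSPCode n s u → length u ≡ n
length-IsWSPCode {n} {u = u} (_ , perm , _) =
  trans (sym (length-map proj₂ u)) (trans (↭-length perm) (length-range 0 n))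

record IsDecomposition (n s : ℕ) (u : List Entry) (r : List Entry × List ℕ) : Set where
  field
    weights     : proj₂ r ≡ fixedWeights 1 u
    derangement : fixedWeights 1 (proj₁ r) ≡ []
    code        : IsWSPCode (length (proj₁ r)) s (proj₁ r)
    rebuilds    : rebuild (proj₁ r) (proj₂ r) ≡ u
    lengths     : length (proj₁ r) + length (proj₂ r) ≡ n
    weights-↭   : map proj₁ u ↭ map proj₁ (proj₁ r) ++ proj₂ r

decompose-correct : ∀ n s u → IsWSPCode n s u → IsDecomposition n s u (decompose n u)
decompose-correct zero s [] code = record
  { weights = refl ; derangement = refl ; code = code ; rebuilds = refl ; lengths = refl
  ; weights-↭ = ↭-reflexive (sym (++-identityʳ _)) }
decompose-correct zero s (_ ∷ _) code with length-IsWSPCode code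
... | ()
decompose-correct (suc k) s u code with firstFixed 1 u in found
... | nothing = record
  { weights     = sym none
  ; derangement = none
  ; code        = subst (λ n → IsWSPCode n s u) (sym (length-IsWSPCode code)) code
  ; rebuilds    = refl
  ; lengths     = trans (+-identityʳ _) (length-IsWSPCode code)
  ; weights-↭   = ↭-reflexive (sym (++-identityʳ _))
  }
  where none = firstFixed≡nothing⇒fixedWeights≡[] 1 u found
... | just (pre , (v , q) , post) = record
  { weights     = trans (cong (v ∷_) (IsDecomposition.weights ih))
                        (sym (trans (cong (fixedWeights 1) u≡)
                                    (fixedWeights-removeFixed v q pre post noneBefore q≡ ne)))
  ; derangement = IsDecomposition.derangement ih
  ; code        = IsDecomposition.code ih
  ; rebuilds    = trans (cong (insertFixed v) (IsDecomposition.rebuilds ih))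
                        (trans (insertFixed-removeFixed v q pre post (subst (Linked Precedes) u≡ (proj₁ code))
                                                        noneBefore q≡ ne)
                               (sym u≡))
  ; lengths     = trans (+-suc _ _) (cong suc (IsDecomposition.lengths ih))
  ; weights-↭   = ↭-trans (subst (λ l → map proj₁ l ↭ _) (sym u≡) (weights-removeFixed v q pre post))
                  (↭-trans (prep v (IsDecomposition.weights-↭ ih))
                           (↭-sym (shift v (map proj₁ (proj₁ rest)) (proj₂ rest))))
  }
  where
  spec       = firstFixed≡just 1 u found
  u≡         = FirstFixed.split spec
  q≡         = FirstFixed.position spec
  noneBefore = FirstFixed.noneBefore spec
  removed    = IsWSPCode-removeFixed k s v q pre post (subst (IsWSPCode (suc k) s) u≡ code)
  ne         = proj₂ removed
  rest       = decompose k (removeFixed q pre post)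
  ih         = decompose-correct k s (removeFixed q pre post) (proj₁ removed)

decompose-injective : ∀ {n s u₁ u₂} → IsWSPCode n s u₁ → IsWSPCode n s u₂ →
                      decompose n u₁ ≡ decompose n u₂ → u₁ ≡ u₂
decompose-injective {n} {s} {u₁} {u₂} code₁ code₂ eq =
  trans (sym (IsDecomposition.rebuilds (decompose-correct n s u₁ code₁)))
        (trans (cong (λ r → rebuild (proj₁ r) (proj₂ r)) eq)
               (IsDecomposition.rebuilds (decompose-correct n s u₂ code₂)))

IsFixedWeights : ℕ → List ℕ → Set
IsFixedWeights s z = Linked FixedStep z × All (_≤ s) z

decompose-derangement : ∀ i D → fixedWeights 1 D ≡ [] → decompose i D ≡ (D , [])
decompose-derangement zero    D _    = refl
decompose-derangement (suc i) D none rewrite fixedWeights≡[]⇒firstFixed≡nothing 1 D none = refl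

rebuild-correct : ∀ i s D z → IsWSPCode i s D → fixedWeights 1 D ≡ [] → IsFixedWeights s z →
                  IsWSPCode (length z + i) s (rebuild D z) ×
                  decompose (length z + i) (rebuild D z) ≡ (D , z)
rebuild-correct i s D []      code none _                = code , decompose-derangement i D none
rebuild-correct i s D (v ∷ z) code none (lz , v≤s ∷ z≤s) =
  IsWSPCode-insertFixed (length z + i) s v u code′ v≤s steps ,
  trans (decompose-insertFixed v u (length z + i) steps) (cong (map₂ (v ∷_)) decomposes)
  where
  u          = rebuild D z
  ih         = rebuild-correct i s D z code none (Linked.tail lz , z≤s)
  code′      = proj₁ ih
  decomposes = proj₂ ih
  z≡ : z ≡ fixedWeights 1 u
  z≡ = trans (cong proj₂ (sym decomposes))
             (IsDecomposition.weights (decompose-correct (length z + i) s u code′))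
  steps : All (FixedStep v) (fixedWeights 1 u)
  steps = subst (All (FixedStep v)) z≡ (Linked-head-All FixedStep-trans lz)

fixedWeights-after : ∀ c a p l → All (Precedes (c , a)) l → a < p → All (FixedStep c) (fixedWeights p l)
fixedWeights-after c a p []              _                    _   = []
fixedWeights-after c a p ((c′ , a′) ∷ l) ((c′≤c , lt) ∷ rest) a<p with a′ ≟ p
... | yes refl = (c′≤c , λ odd c′≡c → notOdd (isEven c) odd (lt (sym c′≡c)))
               ∷ fixedWeights-after c a (suc p) l rest (m<n⇒m<1+n a<p)
  where
  notOdd : ∀ b → b ≡ false → AbsLt b a a′ → ⊥
  notOdd false _ a′<a = <-asym a′<a a<p
... | no  _    = fixedWeights-after c a (suc p) l rest (m<n⇒m<1+n a<p)

Linked-fixedWeights : ∀ p l → Linked Precedes l → Linked FixedStep (fixedWeights p l)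
Linked-fixedWeights p []            _  = []
Linked-fixedWeights p ((c , a) ∷ l) lk with a ≟ p
... | yes refl = Linked-∷⁺ (fixedWeights-after c a (suc p) l (Linked-head-All Precedes-trans lk) ≤-refl)
                           (Linked-fixedWeights (suc p) l (Linked.tail lk))
... | no  _    = Linked-fixedWeights (suc p) l (Linked.tail lk)

All-fixedWeights : ∀ {P : ℕ → Set} p l → All P (map proj₁ l) → All P (fixedWeights p l)
All-fixedWeights p []            _          = []
All-fixedWeights p ((c , a) ∷ l) (pc ∷ ps) with a ≟ p
... | yes _ = pc ∷ All-fixedWeights (suc p) l ps
... | no  _ = All-fixedWeights (suc p) l ps

weights≤ : ∀ {n s} u → IsWSPCode n s u → All (_≤ s) (map proj₁ u)
weights≤ []      _              = []
weights≤ (e ∷ u) (lk , _ , hd) =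
  hd ∷ All.map (λ c≤ → ≤-trans c≤ hd) (All.map⁺ (All.map proj₁ (Linked-head-All Precedes-trans lk)))

fixedWeights-IsFixedWeights : ∀ {n s} u → IsWSPCode n s u → IsFixedWeights s (fixedWeights 1 u)
fixedWeights-IsFixedWeights u code = Linked-fixedWeights 1 u (proj₁ code) , All-fixedWeights 1 u (weights≤ u code)

merge-evens-odds : ∀ z → Linked FixedStep z → merge _>?_ (evens z) (odds z) ≡ z
merge-evens-odds []      _  = refl
merge-evens-odds (x ∷ z) lk with isEven x in parity
... | true  =
  trans (merge-∷ˡ x (evens z) (odds z) (All.zipWith below (All.all-filter odd? z , All.filter⁺ odd? steps)))
        (cong (x ∷_) (merge-evens-odds z (Linked.tail lk)))
  where
  steps = Linked-head-All FixedStep-trans lk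
  below : ∀ {y} → IsOdd y × FixedStep x y → y < x
  below {y} (odd , y≤x , _) = ≤∧≢⇒< y≤x (parity-≢ {x} {y} parity odd ∘ sym)
... | false =
  trans (merge-∷ʳ (evens z) x (odds z) (All.map below (All.filter⁺ even? (Linked-head-All FixedStep-trans lk))))
        (cong (x ∷_) (merge-evens-odds z (Linked.tail lk)))
  where
  below : ∀ {y} → FixedStep x y → y < x
  below (y≤x , odd-y≢x) = ≤∧≢⇒< y≤x (odd-y≢x parity)

evens-merge : ∀ xs ys → All IsEven xs → All IsOdd ys → evens (merge _>?_ xs ys) ≡ xs
evens-merge []       []       _           _          = refl
evens-merge []       (y ∷ ys) _           (odd ∷ os) =
  trans (filter-reject even? {y} (odd⇒¬even {y} odd)) (evens-merge [] ys [] os)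
evens-merge (x ∷ xs) []       (even ∷ es) _          =
  trans (filter-accept even? {x} even)
        (cong (x ∷_) (trans (cong evens (sym (merge-[]ʳ xs))) (evens-merge xs [] es [])))
evens-merge (x ∷ xs) (y ∷ ys) (even ∷ es) (odd ∷ os) = merge-∷-∷ {λ l → evens l ≡ x ∷ xs} x xs y ys
  (λ _ → trans (filter-accept even? {x} even) (cong (x ∷_) (evens-merge xs (y ∷ ys) es (odd ∷ os))))
  (λ _ → trans (filter-reject even? {y} (odd⇒¬even {y} odd)) (evens-merge (x ∷ xs) ys (even ∷ es) os))

odds-merge : ∀ xs ys → All IsEven xs → All IsOdd ys → odds (merge _>?_ xs ys) ≡ ys
odds-merge []       []       _           _          = refl
odds-merge []       (y ∷ ys) _           (odd ∷ os) =
  trans (filter-accept odd? {y} odd) (cong (y ∷_) (odds-merge [] ys [] os))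
odds-merge (x ∷ xs) []       (even ∷ es) _          =
  trans (filter-reject odd? {x} (even⇒¬odd {x} even))
        (trans (cong odds (sym (merge-[]ʳ xs))) (odds-merge xs [] es []))
odds-merge (x ∷ xs) (y ∷ ys) (even ∷ es) (odd ∷ os) = merge-∷-∷ {λ l → odds l ≡ y ∷ ys} x xs y ys
  (λ _ → trans (filter-reject odd? {x} (even⇒¬odd {x} even)) (odds-merge xs (y ∷ ys) es (odd ∷ os)))
  (λ _ → trans (filter-accept odd? {y} odd) (cong (y ∷_) (odds-merge (x ∷ xs) ys (even ∷ es) os)))

Linked-merge : ∀ xs ys → All IsEven xs → All IsOdd ys →
               Linked FixedStep xs → Linked FixedStep ys → Linked FixedStep (merge _>?_ xs ys)
Linked-merge []       ys       _           _          _   lys = lys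
Linked-merge (x ∷ xs) []       _           _          lxs _   = lxs
Linked-merge (x ∷ xs) (y ∷ ys) (even ∷ es) (odd ∷ os) lxs lys = merge-∷-∷ {Linked FixedStep} x xs y ys
  (λ y<x → let step = <⇒≤ y<x , λ _ y≡x → <-irrefl y≡x y<x in
    Linked-∷⁺ (All-merge (Linked-head-All FixedStep-trans lxs)
                         (step ∷ All.map (FixedStep-trans step) (Linked-head-All FixedStep-trans lys)))
              (Linked-merge xs (y ∷ ys) es (odd ∷ os) (Linked.tail lxs) lys))
  (λ x≤y → let step = x≤y , λ _ → parity-≢ {x} {y} even odd in
    Linked-∷⁺ (All-merge (step ∷ All.map (FixedStep-trans step) (Linked-head-All FixedStep-trans lxs))
                         (Linked-head-All FixedStep-trans lys))
              (Linked-merge (x ∷ xs) ys (even ∷ es) os lxs (Linked.tail lys)))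

↭-evens-odds : ∀ z → Linked FixedStep z → z ↭ evens z ++ odds z
↭-evens-odds z lk = subst (_↭ evens z ++ odds z) (merge-evens-odds z lk) (merge-↭ _>?_ (evens z) (odds z))

evens-NIWe : ∀ s z → IsFixedWeights s z →
             NonIncreasing (toList (fromList (evens z))) ×
             All (λ x → Even x × x ≤ s) (toList (fromList (evens z)))
evens-NIWe s z (lz , z≤s) rewrite toList∘fromList (evens z) =
  Linked.map proj₁ (Linked.filter⁺ even? FixedStep-trans lz) ,
  All.zipWith (λ {x} (even , x≤s) → IsEven⇒Even x even , x≤s)
              (All.all-filter even? z , All.filter⁺ even? z≤s)

odds-DWo : ∀ s z → IsFixedWeights s z →
           StrictlyDecreasing (toList (fromList (odds z))) ×
           All (λ x → Odd x × x ≤ s) (toList (fromList (odds z)))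
odds-DWo s z (lz , z≤s) rewrite toList∘fromList (odds z) =
  Linked-mono (λ odd _ (y≤x , odd-y≢x) → ≤∧≢⇒< y≤x (odd-y≢x odd))
              (All.all-filter odd? z) (Linked.filter⁺ odd? FixedStep-trans lz) ,
  All.zipWith (λ {x} (odd , x≤s) → IsOdd⇒Odd x odd , x≤s)
              (All.all-filter odd? z , All.filter⁺ odd? z≤s)

NIWe-IsFixedWeights : ∀ {j s} (v : Vec ℕ j) → NonIncreasing (toList v) →
                      All (λ x → Even x × x ≤ s) (toList v) →
                      All IsEven (toList v) × IsFixedWeights s (toList v)
NIWe-IsFixedWeights v ni bounds =
  allEven ,
  Linked-mono (λ {x} even _ y≤x → y≤x , λ odd → ⊥-elim (even⇒¬odd {x} even odd)) allEven ni ,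
  All.map proj₂ bounds
  where allEven = All.map (λ {x} → Even⇒IsEven x ∘ proj₁) bounds

DWo-IsFixedWeights : ∀ {k s} (v : Vec ℕ k) → StrictlyDecreasing (toList v) →
                     All (λ x → Odd x × x ≤ s) (toList v) →
                     All IsOdd (toList v) × IsFixedWeights s (toList v)
DWo-IsFixedWeights v sd bounds =
  All.map (λ {x} → Odd⇒IsOdd x ∘ proj₁) bounds ,
  Linked.map (λ y<x → <⇒≤ y<x , λ _ y≡x → <-irrefl y≡x y<x) sd ,
  All.map proj₂ bounds

signed : Bool → ℕ → ℤ
signed true  a = + a
signed false a = - (+ a)

letter : Entry → ℤ
letter (c , a) = signed (isEven c) a

∣signed∣ : ∀ b a → ∣ signed b a ∣ ≡ a
∣signed∣ true  a       = refl
∣signed∣ false zero    = refl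
∣signed∣ false (suc a) = refl

encode : ∀ {n} → Vec ℕ n → Vec ℤ n → List Entry
encode Vec.[]       Vec.[]       = []
encode (c Vec.∷ cs) (x Vec.∷ xs) = (c , ∣ x ∣) ∷ encode cs xs

-- Lists shorter than n are padded with zeros; this only happens on lists that are not codes.
decode : (n : ℕ) → List Entry → Vec ℕ n × Vec ℤ n
decode zero    _             = Vec.[] , Vec.[]
decode (suc n) []            = 0 Vec.∷ proj₁ (decode n []) , + 0 Vec.∷ proj₂ (decode n [])
decode (suc n) ((c , a) ∷ u) = c Vec.∷ proj₁ (decode n u) , letter (c , a) Vec.∷ proj₂ (decode n u)

length-encode : ∀ {n} (c : Vec ℕ n) (w : Vec ℤ n) → length (encode c w) ≡ n
length-encode Vec.[]       Vec.[]       = refl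
length-encode (_ Vec.∷ cs) (_ Vec.∷ xs) = cong suc (length-encode cs xs)

encode-decode : ∀ n u → length u ≡ n → encode (proj₁ (decode n u)) (proj₂ (decode n u)) ≡ u
encode-decode zero    []            _   = refl
encode-decode (suc n) ((c , a) ∷ u) len =
  cong₂ _∷_ (cong (c ,_) (∣signed∣ (isEven c) a)) (encode-decode n u (suc-injective len))

toList-decode-weights : ∀ n u → length u ≡ n → toList (proj₁ (decode n u)) ≡ map proj₁ u
toList-decode-weights zero    []            _   = refl
toList-decode-weights (suc n) ((c , _) ∷ u) len =
  cong (c ∷_) (toList-decode-weights n u (suc-injective len))

toList-decode-letters : ∀ n u → length u ≡ n → toList (proj₂ (decode n u)) ≡ map letter u
toList-decode-letters zero    []      _   = refl
toList-decode-letters (suc n) (e ∷ u) len =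
  cong (letter e ∷_) (toList-decode-letters n u (suc-injective len))

toList-decode-zip : ∀ n u → length u ≡ n →
                    toList (Vec.zip (proj₁ (decode n u)) (proj₂ (decode n u))) ≡
                    map (λ e → proj₁ e , letter e) u
toList-decode-zip zero    []      _   = refl
toList-decode-zip (suc n) (e ∷ u) len = cong (_ ∷_) (toList-decode-zip n u (suc-injective len))

SignCond⇒IsEven : ∀ {c m} → SignCond (c , + m) → IsEven c
SignCond⇒IsEven {c} (_ , odd⇒neg) with isEven⊎isOdd c
... | inj₁ (even , _) = even
... | inj₂ (_ , odd) with odd⇒neg odd
...   | ℤ.+<+ ()

SignCond⇒IsOdd : ∀ {c k} → SignCond (c , -[1+ k ]) → IsOdd c
SignCond⇒IsOdd {c} (even⇒pos , _) with isEven⊎isOdd c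
... | inj₂ (odd , _)  = odd
... | inj₁ (_ , even) with even⇒pos even
...   | ()

SignCond⇒signed : ∀ c x → SignCond (c , x) → x ≡ signed (isEven c) ∣ x ∣
SignCond⇒signed c (+ m)    sc rewrite SignCond⇒IsEven {c} {m} sc = refl
SignCond⇒signed c -[1+ k ] sc rewrite SignCond⇒IsOdd {c} {k} sc  = refl

SignCond-signed : ∀ c a → 1 ≤ a → SignCond (c , signed (isEven c) a)
SignCond-signed c a 1≤a with isEven⊎isOdd c
... | inj₁ (even , c%2≡0) rewrite even =
  (λ _ → ℤ.+<+ 1≤a) , λ c%2≡1 → ⊥-elim (0≢1+n (trans (sym c%2≡0) c%2≡1))
SignCond-signed c (suc a) _ | inj₂ (odd , c%2≡1) rewrite odd =
  (λ c%2≡0 → ⊥-elim (0≢1+n (trans (sym c%2≡0) c%2≡1))) , λ _ → ℤ.-<+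

decode-encode : ∀ {n} (c : Vec ℕ n) (w : Vec ℤ n) → All SignCond (toList (Vec.zip c w)) →
                (c , w) ≡ decode n (encode c w)
decode-encode Vec.[]       Vec.[]       _          = refl
decode-encode (c Vec.∷ cs) (x Vec.∷ xs) (sc ∷ scs) =
  cong₂ (λ rest x′ → c Vec.∷ proj₁ rest , x′ Vec.∷ proj₂ rest)
        (decode-encode cs xs scs) (SignCond⇒signed c x sc)

signed-<⇒AbsLt : ∀ b a a′ → signed b a ℤ.< signed b a′ → AbsLt b a a′
signed-<⇒AbsLt true  a       a′       (ℤ.+<+ a<a′) = a<a′
signed-<⇒AbsLt false (suc k) (suc k′) (ℤ.-<- k′<k) = s≤s k′<k
signed-<⇒AbsLt false (suc k) zero     _            = s≤s z≤n
signed-<⇒AbsLt false zero    zero     (ℤ.+<+ ())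
signed-<⇒AbsLt false zero    (suc k′) ()

AbsLt⇒signed-< : ∀ b a a′ → 1 ≤ a → 1 ≤ a′ → AbsLt b a a′ → signed b a ℤ.< signed b a′
AbsLt⇒signed-< true  a       a′       _ _ a<a′          = ℤ.+<+ a<a′
AbsLt⇒signed-< false (suc k) (suc k′) _ _ (s≤s k′<k) = ℤ.-<- k′<k

applyUpTo≡range : ∀ (f : ℕ → ℕ) a n → (∀ i → f i ≡ suc (a + i)) → applyUpTo f n ≡ range a n
applyUpTo≡range f a zero    _  = refl
applyUpTo≡range f a (suc n) f≡ =
  cong₂ _∷_ (trans (f≡ 0) (cong suc (+-identityʳ a)))
            (applyUpTo≡range (f ∘ suc) (suc a) n (λ i → trans (f≡ (suc i)) (cong suc (+-suc a i))))

map-suc-upTo : ∀ n → map suc (upTo n) ≡ range 0 n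
map-suc-upTo n = trans (map-applyUpTo (λ i → i) suc n) (applyUpTo≡range suc 0 n (λ _ → refl))

Linked-encode : ∀ {n} (c : Vec ℕ n) (w : Vec ℤ n) → NonIncreasing (toList c) →
                Linked TieCond (toList (Vec.zip c w)) → All SignCond (toList (Vec.zip c w)) →
                Linked Precedes (encode c w)
Linked-encode Vec.[]           Vec.[]           _ _ _ = []
Linked-encode (_ Vec.∷ Vec.[]) (_ Vec.∷ Vec.[]) _ _ _ = [-]
Linked-encode (c₁ Vec.∷ c₂ Vec.∷ cs) (x₁ Vec.∷ x₂ Vec.∷ xs)
              (c₂≤c₁ ∷ ni) (tie ∷ ties) (sc₁ ∷ sc₂ ∷ scs) =
  (c₂≤c₁ , absLt) ∷ Linked-encode (c₂ Vec.∷ cs) (x₂ Vec.∷ xs) ni ties (sc₂ ∷ scs)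
  where
  absLt : c₁ ≡ c₂ → AbsLt (isEven c₁) ∣ x₁ ∣ ∣ x₂ ∣
  absLt refl = signed-<⇒AbsLt (isEven c₁) ∣ x₁ ∣ ∣ x₂ ∣
                 (subst₂ ℤ._<_ (SignCond⇒signed c₁ x₁ sc₁) (SignCond⇒signed c₁ x₂ sc₂) (tie refl))

map-∣∣-encode : ∀ {n} (c : Vec ℕ n) (w : Vec ℤ n) → map ∣_∣ (toList w) ≡ map proj₂ (encode c w)
map-∣∣-encode Vec.[]       Vec.[]       = refl
map-∣∣-encode (_ Vec.∷ cs) (x Vec.∷ xs) = cong (∣ x ∣ ∷_) (map-∣∣-encode cs xs)

IsWSP⇒IsWSPCode : ∀ {n s} (c : Vec ℕ n) (w : Vec ℤ n) → IsWSP n s (c , w) →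
                  IsWSPCode n s (encode c w)
IsWSP⇒IsWSPCode {n} c w (ni , perm , ties , signs , hd) =
  Linked-encode c w ni ties signs , subst₂ _↭_ (map-∣∣-encode c w) (map-suc-upTo n) perm , head c w hd
  where
  head : ∀ {n s} (c : Vec ℕ n) (w : Vec ℤ n) → HeadBound s (toList c) → HeadWeight≤ s (encode c w)
  head Vec.[]      Vec.[]      _  = tt
  head (_ Vec.∷ _) (_ Vec.∷ _) hd = hd

values-positive : ∀ {n s u} → IsWSPCode n s u → All (λ e → 1 ≤ proj₂ e) u
values-positive {n} (_ , perm , _) =
  All.map⁻ (All.map proj₁ (All-resp-↭ (↭-sym perm) (All.tabulate (∈-range 0 n))))

IsWSPCode⇒IsWSP : ∀ {n s} u → IsWSPCode n s u → IsWSP n s (decode n u)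
IsWSPCode⇒IsWSP {n} {s} u code@(lk , perm , hd) =
  subst NonIncreasing (sym (toList-decode-weights n u len)) (Linked.map⁺ (Linked.map proj₁ lk)) ,
  subst₂ _↭_ (sym (trans (cong (map ∣_∣) (toList-decode-letters n u len)) map-∣letter∣))
             (sym (map-suc-upTo n)) perm ,
  subst (Linked TieCond) (sym (toList-decode-zip n u len))
        (Linked.map⁺ (Linked-mono tie (values-positive code) lk)) ,
  subst (All SignCond) (sym (toList-decode-zip n u len))
        (All.map⁺ (All.map (λ {e} → SignCond-signed (proj₁ e) (proj₂ e)) (values-positive code))) ,
  subst (HeadBound s) (sym (toList-decode-weights n u len)) (head u hd)
  where
  len = length-IsWSPCode code
  map-∣letter∣ : map ∣_∣ (map letter u) ≡ map proj₂ u
  map-∣letter∣ = trans (sym (map-∘ u)) (map-cong (λ e → ∣signed∣ (isEven (proj₁ e)) (proj₂ e)) u)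
  tie : ∀ {e e′} → 1 ≤ proj₂ e → 1 ≤ proj₂ e′ → Precedes e e′ →
        TieCond (proj₁ e , letter e) (proj₁ e′ , letter e′)
  tie {c , a} {_ , a′} 1≤a 1≤a′ (_ , absLt) refl = AbsLt⇒signed-< (isEven c) a a′ 1≤a 1≤a′ (absLt refl)
  head : ∀ u → HeadWeight≤ s u → HeadBound s (map proj₁ u)
  head []      _  = tt
  head (_ ∷ _) hd = hd

oddness : ℕ → ℕ
oddness x = Bool.if isEven x then 0 else 1

sum-oddness : ∀ z → sum (map oddness z) ≡ length (odds z)
sum-oddness []      = refl
sum-oddness (x ∷ z) with isEven x
... | true  = sum-oddness z
... | false = cong suc (sum-oddness z)

negV-encode : ∀ {n} (c : Vec ℕ n) (w : Vec ℤ n) → All SignCond (toList (Vec.zip c w)) →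
              negV w ≡ sum (map oddness (map proj₁ (encode c w)))
negV-encode Vec.[]       Vec.[]              _          = refl
negV-encode (c Vec.∷ cs) (+ m Vec.∷ xs)      (sc ∷ scs) rewrite SignCond⇒IsEven {c} {m} sc =
  negV-encode cs xs scs
negV-encode (c Vec.∷ cs) (-[1+ k ] Vec.∷ xs) (sc ∷ scs) rewrite SignCond⇒IsOdd {c} {k} sc =
  cong suc (negV-encode cs xs scs)

tot-encode : ∀ {n} (c : Vec ℕ n) (w : Vec ℤ n) → tot c ≡ sum (map proj₁ (encode c w))
tot-encode Vec.[]       Vec.[]       = refl
tot-encode (c Vec.∷ cs) (_ Vec.∷ xs) = cong (λ t → c + t) (tot-encode cs xs)

fixPlusFrom-hit : ∀ i x xs → x ≡ + i → fixPlusFrom i (x ∷ xs) ≡ suc (fixPlusFrom (suc i) xs)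
fixPlusFrom-hit i x xs x≡ with x ℤ.≟ + i
... | yes _  = refl
... | no x≢ = ⊥-elim (x≢ x≡)

fixPlusFrom-miss : ∀ i x xs → x ≢ + i → fixPlusFrom i (x ∷ xs) ≡ fixPlusFrom (suc i) xs
fixPlusFrom-miss i x xs x≢ with x ℤ.≟ + i
... | yes x≡ = ⊥-elim (x≢ x≡)
... | no _   = refl

fixMinusFrom-hit : ∀ i x xs → x ≡ - (+ i) → fixMinusFrom i (x ∷ xs) ≡ suc (fixMinusFrom (suc i) xs)
fixMinusFrom-hit i x xs x≡ with x ℤ.≟ - (+ i)
... | yes _  = refl
... | no x≢ = ⊥-elim (x≢ x≡)

fixMinusFrom-miss : ∀ i x xs → x ≢ - (+ i) → fixMinusFrom i (x ∷ xs) ≡ fixMinusFrom (suc i) xs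
fixMinusFrom-miss i x xs x≢ with x ℤ.≟ - (+ i)
... | yes x≡ = ⊥-elim (x≢ x≡)
... | no _   = refl

evens-fixedWeights-odd : ∀ p c a l → IsOdd c →
                         evens (fixedWeights p ((c , a) ∷ l)) ≡ evens (fixedWeights (suc p) l)
evens-fixedWeights-odd p c a l odd with a ≟ p
... | yes _ = filter-reject even? {c} (odd⇒¬even {c} odd)
... | no  _ = refl

odds-fixedWeights-even : ∀ p c a l → IsEven c →
                         odds (fixedWeights p ((c , a) ∷ l)) ≡ odds (fixedWeights (suc p) l)
odds-fixedWeights-even p c a l even with a ≟ p
... | yes _ = filter-reject odd? {c} (even⇒¬odd {c} even)
... | no  _ = refl

fix⁺-encode : ∀ {n} p (c : Vec ℕ n) (w : Vec ℤ n) → All SignCond (toList (Vec.zip c w)) →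
              fixPlusFrom p (toList w) ≡ length (evens (fixedWeights p (encode c w)))
fix⁺-encode p Vec.[]       Vec.[]       _ = refl
fix⁺-encode p (c Vec.∷ cs) (+ m Vec.∷ xs) (sc ∷ scs) = byValue (m ≟ p)
  where
  ih = fix⁺-encode (suc p) cs xs scs
  byValue : Dec (m ≡ p) →
            fixPlusFrom p (+ m ∷ toList xs) ≡ length (evens (fixedWeights p ((c , m) ∷ encode cs xs)))
  byValue (yes m≡p) =
    trans (fixPlusFrom-hit p (+ m) (toList xs) (cong +_ m≡p))
          (trans (cong suc ih)
                 (sym (trans (cong (length ∘ evens) (fixedWeights-fixed p c m (encode cs xs) m≡p))
                             (cong length (filter-accept even? {c} (SignCond⇒IsEven {c} {m} sc))))))
  byValue (no  m≢p) =
    trans (fixPlusFrom-miss p (+ m) (toList xs) (m≢p ∘ ℤ.+-injective))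
          (trans ih (cong (length ∘ evens) (sym (fixedWeights-unfixed p c m (encode cs xs) m≢p))))
fix⁺-encode p (c Vec.∷ cs) (-[1+ k ] Vec.∷ xs) (sc ∷ scs) =
  trans (fixPlusFrom-miss p -[1+ k ] (toList xs) (λ ()))
        (trans (fix⁺-encode (suc p) cs xs scs)
               (cong length (sym (evens-fixedWeights-odd p c (suc k) (encode cs xs)
                                                         (SignCond⇒IsOdd {c} {k} sc)))))

-- Positions start at suc p: at position 0 the letter + 0 would count as a negative fixed point.
fix⁻-encode : ∀ {n} p (c : Vec ℕ n) (w : Vec ℤ n) → All SignCond (toList (Vec.zip c w)) →
              fixMinusFrom (suc p) (toList w) ≡ length (odds (fixedWeights (suc p) (encode c w)))
fix⁻-encode p Vec.[]       Vec.[]       _ = refl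
fix⁻-encode p (c Vec.∷ cs) (+ m Vec.∷ xs) (sc ∷ scs) =
  trans (fixMinusFrom-miss (suc p) (+ m) (toList xs) (λ ()))
        (trans (fix⁻-encode (suc p) cs xs scs)
               (cong length (sym (odds-fixedWeights-even (suc p) c m (encode cs xs)
                                                         (SignCond⇒IsEven {c} {m} sc)))))
fix⁻-encode p (c Vec.∷ cs) (-[1+ k ] Vec.∷ xs) (sc ∷ scs) = byValue (k ≟ p)
  where
  ih = fix⁻-encode (suc p) cs xs scs
  byValue : Dec (k ≡ p) → fixMinusFrom (suc p) (-[1+ k ] ∷ toList xs) ≡
                          length (odds (fixedWeights (suc p) ((c , suc k) ∷ encode cs xs)))
  byValue (yes k≡p) =
    trans (fixMinusFrom-hit (suc p) -[1+ k ] (toList xs) (cong (λ i → - (+ suc i)) k≡p))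
          (trans (cong suc ih)
                 (sym (trans (cong (length ∘ odds)
                                   (fixedWeights-fixed (suc p) c (suc k) (encode cs xs) (cong suc k≡p)))
                             (cong length (filter-accept odd? {c} (SignCond⇒IsOdd {c} {k} sc))))))
  byValue (no  k≢p) =
    trans (fixMinusFrom-miss (suc p) -[1+ k ] (toList xs) (k≢p ∘ ℤ.-[1+-injective))
          (trans ih (cong (length ∘ odds)
                          (sym (fixedWeights-unfixed (suc p) c (suc k) (encode cs xs) (k≢p ∘ suc-injective)))))

NoFixedPointsFrom : ∀ {n} → ℕ → Vec ℤ n → Set
NoFixedPointsFrom {n} q w =
  (i : Fin n) → Vec.lookup w i ≢ + (q + toℕ i) × Vec.lookup w i ≢ - (+ (q + toℕ i))

NoFixedPointsFrom⇒fixedWeights≡[] : ∀ {n} q (c : Vec ℕ n) (w : Vec ℤ n) → NoFixedPointsFrom q w →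
                                    fixedWeights q (encode c w) ≡ []
NoFixedPointsFrom⇒fixedWeights≡[] q Vec.[]       Vec.[]       _    = refl
NoFixedPointsFrom⇒fixedWeights≡[] q (c Vec.∷ cs) (x Vec.∷ xs) none =
  trans (fixedWeights-unfixed q c ∣ x ∣ (encode cs xs) (∣x∣≢q x (none Fin.zero)))
        (NoFixedPointsFrom⇒fixedWeights≡[] (suc q) cs xs λ i →
           subst (λ r → Vec.lookup xs i ≢ + r × Vec.lookup xs i ≢ - (+ r)) (+-suc q (toℕ i)) (none (Fin.suc i)))
  where
  ∣x∣≢q : ∀ x → x ≢ + (q + 0) × x ≢ - (+ (q + 0)) → ∣ x ∣ ≢ q
  ∣x∣≢q (+ m)    (x≢q , _)  refl = x≢q (cong +_ (sym (+-identityʳ m)))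
  ∣x∣≢q -[1+ k ] (_ , x≢-q) refl = x≢-q (cong (λ r → - (+ r)) (sym (+-identityʳ (suc k))))

fixedWeights≡[]⇒NoFixedPointsFrom : ∀ {n} q (c : Vec ℕ n) (w : Vec ℤ n) → fixedWeights q (encode c w) ≡ [] →
                                    NoFixedPointsFrom q w
fixedWeights≡[]⇒NoFixedPointsFrom q (c Vec.∷ cs) (x Vec.∷ xs) none Fin.zero =
  (λ x≡ → ∣x∣≢q (trans (cong ∣_∣ x≡) (+-identityʳ q))) ,
  (λ x≡ → ∣x∣≢q (trans (cong ∣_∣ x≡) (trans (∣signed∣ false (q + 0)) (+-identityʳ q))))
  where ∣x∣≢q = proj₁ (fixedWeights-∷≡[] q c ∣ x ∣ (encode cs xs) none)
fixedWeights≡[]⇒NoFixedPointsFrom q (c Vec.∷ cs) (x Vec.∷ xs) none (Fin.suc i) =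
  subst (λ r → Vec.lookup xs i ≢ + r × Vec.lookup xs i ≢ - (+ r)) (sym (+-suc q (toℕ i)))
        (fixedWeights≡[]⇒NoFixedPointsFrom (suc q) cs xs
                                            (proj₂ (fixedWeights-∷≡[] q c ∣ x ∣ (encode cs xs) none)) i)

-- The bijection

IsWSP⇒SignCond : ∀ {n s c w} → IsWSP n s (c , w) → All SignCond (toList (Vec.zip c w))
IsWSP⇒SignCond (_ , _ , _ , signs , _) = signs

tuple : List Entry × List ℕ → TupleData
tuple (D , z) =
  (length D , length (evens z) , length (odds z)) , decode (length D) D , fromList (evens z) , fromList (odds z)

untuple : TupleData → List Entry × List ℕ
untuple (_ , (c , w) , ve , vo) = encode c w , merge _>?_ (toList ve) (toList vo)

fromList-toList : ∀ {j} (v : Vec ℕ j) → _≡_ {A = Σ ℕ (Vec ℕ)} (length (toList v) , fromList (toList v)) (j , v)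
fromList-toList Vec.[]      = refl
fromList-toList (x Vec.∷ v) with length (toList v) | fromList (toList v) | fromList-toList v
... | _ | _ | refl = refl

decode-encode-Σ : ∀ {i} (c : Vec ℕ i) (w : Vec ℤ i) → All SignCond (toList (Vec.zip c w)) →
                  _≡_ {A = Σ ℕ λ i → Vec ℕ i × Vec ℤ i}
                      (length (encode c w) , decode (length (encode c w)) (encode c w)) (i , (c , w))
decode-encode-Σ {i} c w signs with length (encode c w) | length-encode c w
... | _ | refl = cong (i ,_) (sym (decode-encode c w signs))

TupleData-≡ : ∀ {i₁ i₂ j₁ j₂ k₁ k₂} {cw₁ : Vec ℕ i₁ × Vec ℤ i₁} {cw₂ : Vec ℕ i₂ × Vec ℤ i₂}
                {v₁ : Vec ℕ j₁} {v₂ : Vec ℕ j₂} {o₁ : Vec ℕ k₁} {o₂ : Vec ℕ k₂} →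
              _≡_ {A = Σ ℕ λ i → Vec ℕ i × Vec ℤ i} (i₁ , cw₁) (i₂ , cw₂) →
              _≡_ {A = Σ ℕ (Vec ℕ)} (j₁ , v₁) (j₂ , v₂) →
              _≡_ {A = Σ ℕ (Vec ℕ)} (k₁ , o₁) (k₂ , o₂) →
              _≡_ {A = TupleData} ((i₁ , j₁ , k₁) , cw₁ , v₁ , o₁) ((i₂ , j₂ , k₂) , cw₂ , v₂ , o₂)
TupleData-≡ refl refl refl = refl

tuple-untuple : ∀ {i j k} (c : Vec ℕ i) (w : Vec ℤ i) (ve : Vec ℕ j) (vo : Vec ℕ k) →
                All SignCond (toList (Vec.zip c w)) → All IsEven (toList ve) → All IsOdd (toList vo) →
                tuple (untuple ((i , j , k) , (c , w) , ve , vo)) ≡ ((i , j , k) , (c , w) , ve , vo)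
tuple-untuple c w ve vo signs evens odds
  rewrite evens-merge (toList ve) (toList vo) evens odds | odds-merge (toList ve) (toList vo) evens odds =
  TupleData-≡ (decode-encode-Σ c w signs) (fromList-toList ve) (fromList-toList vo)

module _ {n s u} (code : IsWSPCode n s u) where
  private
    dec = decompose-correct n s u code
    D   = proj₁ (decompose n u)
    z   = proj₂ (decompose n u)
    c′  = proj₁ (decode (length D) D)
    w′  = proj₂ (decode (length D) D)

  fixedWeights-decompose : IsFixedWeights s z
  fixedWeights-decompose =
    subst (IsFixedWeights s) (sym (IsDecomposition.weights dec)) (fixedWeights-IsFixedWeights u code)

  ↭-decompose : z ↭ evens z ++ odds z
  ↭-decompose = ↭-evens-odds z (proj₁ fixedWeights-decompose)

  untuple-tuple : untuple (tuple (decompose n u)) ≡ decompose n u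
  untuple-tuple = cong₂ _,_ (encode-decode (length D) D refl)
    (trans (cong₂ (merge _>?_) (toList∘fromList (evens z)) (toList∘fromList (odds z)))
           (merge-evens-odds z (proj₁ fixedWeights-decompose)))

  tuple-IsTarget : IsTarget n s (tuple (decompose n u))
  tuple-IsTarget = lengths , (IsWSPCode⇒IsWSP D (IsDecomposition.code dec) , derangement) ,
                   evens-NIWe s z fixedWeights-decompose , odds-DWo s z fixedWeights-decompose
    where
    lengths : length D + length (evens z) + length (odds z) ≡ n
    lengths = trans (+-assoc (length D) _ _)
                    (trans (cong (λ t → length D + t) (sym (trans (↭-length ↭-decompose) (length-++ (evens z)))))
                           (IsDecomposition.lengths dec))
    derangement : NoFixedPoints w′
    derangement = fixedWeights≡[]⇒NoFixedPointsFrom 1 c′ w′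
                    (trans (cong (fixedWeights 1) (encode-decode (length D) D refl)) (IsDecomposition.derangement dec))

  sum-weights-decompose : ∀ f → sum (map f (map proj₁ u)) ≡
                                sum (map f (map proj₁ (encode c′ w′))) + sum (map f z)
  sum-weights-decompose f = begin
    sum (map f (map proj₁ u))                 ≡⟨ sum-↭ (map⁺ f (IsDecomposition.weights-↭ dec)) ⟩
    sum (map f (map proj₁ D ++ z))            ≡⟨ cong sum (map-++ f (map proj₁ D) z) ⟩
    sum (map f (map proj₁ D) ++ map f z)      ≡⟨ sum-++ (map f (map proj₁ D)) (map f z) ⟩
    sum (map f (map proj₁ D)) + sum (map f z) ≡⟨ cong (λ l → sum (map f (map proj₁ l)) + sum (map f z))
                                                     (sym (encode-decode (length D) D refl)) ⟩
    sum (map f (map proj₁ (encode c′ w′))) + sum (map f z) ∎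
    where open ≡-Reasoning

toTarget : ∀ n s → WSP n s → Target n s
toTarget n s ((c , w) , wsp) = tuple (decompose n (encode c w)) , tuple-IsTarget (IsWSP⇒IsWSPCode c w wsp)

toTarget-stats : ∀ n s x → StatsOK n s x (toTarget n s x)
toTarget-stats n s ((c , w) , wsp) = totals , negatives , fixed⁺ , fixed⁻
  where
  open ≡-Reasoning
  u    = encode c w
  code = IsWSP⇒IsWSPCode c w wsp
  D    = proj₁ (decompose n u)
  z    = proj₂ (decompose n u)
  c′   = proj₁ (decode (length D) D)
  w′   = proj₂ (decode (length D) D)
  weights≡ = IsDecomposition.weights (decompose-correct n s u code)
  totals : tot c ≡ tot c′ + tot (fromList (evens z)) + tot (fromList (odds z))
  totals = begin
    tot c                                                  ≡⟨ tot-encode c w ⟩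
    sum (map proj₁ u)                                      ≡⟨ cong sum (sym (map-id (map proj₁ u))) ⟩
    sum (map id (map proj₁ u))                             ≡⟨ sum-weights-decompose code id ⟩
    sum (map id (map proj₁ (encode c′ w′))) + sum (map id z)
      ≡⟨ cong₂ _+_ (trans (cong sum (map-id (map proj₁ (encode c′ w′)))) (sym (tot-encode c′ w′)))
                   (trans (cong sum (map-id z)) (trans (sum-↭ (↭-decompose code)) (sum-++ (evens z) (odds z)))) ⟩
    tot c′ + (sum (evens z) + sum (odds z))
      ≡⟨ cong₂ (λ a b → tot c′ + (a + b)) (cong sum (sym (toList∘fromList (evens z))))
                                          (cong sum (sym (toList∘fromList (odds z)))) ⟩
    tot c′ + (tot (fromList (evens z)) + tot (fromList (odds z)))
      ≡⟨ sym (+-assoc (tot c′) _ _) ⟩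
    tot c′ + tot (fromList (evens z)) + tot (fromList (odds z)) ∎
  negatives : negV w ≡ negV w′ + length (odds z)
  negatives = begin
    negV w
      ≡⟨ negV-encode c w (IsWSP⇒SignCond wsp) ⟩
    sum (map oddness (map proj₁ u))
      ≡⟨ sum-weights-decompose code oddness ⟩
    sum (map oddness (map proj₁ (encode c′ w′))) + sum (map oddness z)
      ≡⟨ cong₂ _+_ (sym (negV-encode c′ w′ signs′)) (sum-oddness z) ⟩
    negV w′ + length (odds z) ∎
    where signs′ = IsWSP⇒SignCond (IsWSPCode⇒IsWSP D (IsDecomposition.code (decompose-correct n s u code)))
  fixed⁺ : fix⁺ w ≡ length (evens z)
  fixed⁺ = trans (fix⁺-encode 1 c w (IsWSP⇒SignCond wsp)) (cong (length ∘ evens) (sym weights≡))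
  fixed⁻ : fix⁻ w ≡ length (odds z)
  fixed⁻ = trans (fix⁻-encode 0 c w (IsWSP⇒SignCond wsp)) (cong (length ∘ odds) (sym weights≡))

toTarget-injective : ∀ n s (x y : WSP n s) → proj₁ (toTarget n s x) ≡ proj₁ (toTarget n s y) →
                     proj₁ x ≡ proj₁ y
toTarget-injective n s ((c₁ , w₁) , wsp₁) ((c₂ , w₂) , wsp₂) eq =
  trans (decode-encode c₁ w₁ (IsWSP⇒SignCond wsp₁))
        (trans (cong (decode n) codes≡) (sym (decode-encode c₂ w₂ (IsWSP⇒SignCond wsp₂))))
  where
  code₁ = IsWSP⇒IsWSPCode c₁ w₁ wsp₁
  code₂ = IsWSP⇒IsWSPCode c₂ w₂ wsp₂
  codes≡ : encode c₁ w₁ ≡ encode c₂ w₂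
  codes≡ = decompose-injective code₁ code₂
             (trans (sym (untuple-tuple code₁)) (trans (cong untuple eq) (untuple-tuple code₂)))

toTarget-surjective : ∀ n s (y : Target n s) → Σ (WSP n s) λ x → proj₁ (toTarget n s x) ≡ proj₁ y
toTarget-surjective n s (((i , j , k) , (c′ , w′) , ve , vo) , i+j+k≡n , (wsp′ , derangement) ,
                         (ni , evenBounds) , (sd , oddBounds)) =
  (decode n u , IsWSPCode⇒IsWSP u code) , (begin
    tuple (decompose n (encode (proj₁ (decode n u)) (proj₂ (decode n u))))
      ≡⟨ cong (tuple ∘ decompose n) (encode-decode n u (length-IsWSPCode code)) ⟩
    tuple (decompose n u)
      ≡⟨ cong tuple decomposes ⟩
    tuple (encode c′ w′ , z)
      ≡⟨ tuple-untuple c′ w′ ve vo (IsWSP⇒SignCond wsp′) (proj₁ ve′) (proj₁ vo′) ⟩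
    ((i , j , k) , (c′ , w′) , ve , vo) ∎)
  where
  open ≡-Reasoning
  ve′ = NIWe-IsFixedWeights ve ni evenBounds
  vo′ = DWo-IsFixedWeights vo sd oddBounds
  z = merge _>?_ (toList ve) (toList vo)
  u = rebuild (encode c′ w′) z
  length≡ : length z + i ≡ n
  length≡ = trans (cong (_+ i) (trans (length-merge (toList ve) (toList vo))
                                      (cong₂ _+_ (length-toList ve) (length-toList vo))))
                  (trans (+-comm (j + k) i) (trans (sym (+-assoc i j k)) i+j+k≡n))
  rebuilt = rebuild-correct i s (encode c′ w′) z (IsWSP⇒IsWSPCode c′ w′ wsp′)
              (NoFixedPointsFrom⇒fixedWeights≡[] 1 c′ w′ derangement)
              (Linked-merge (toList ve) (toList vo) (proj₁ ve′) (proj₁ vo′)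
                            (proj₁ (proj₂ ve′)) (proj₁ (proj₂ vo′)) ,
               All-merge (proj₂ (proj₂ ve′)) (proj₂ (proj₂ vo′)))
  code : IsWSPCode n s u
  code = subst (λ m → IsWSPCode m s u) length≡ (proj₁ rebuilt)
  decomposes : decompose n u ≡ (encode c′ w′ , z)
  decomposes = subst (λ m → decompose m u ≡ (encode c′ w′ , z)) length≡ (proj₂ rebuilt)

proposition4p1 : (n s : ℕ) →
    Σ (WSP n s → Target n s) λ f → IsBijection f × (∀ x → StatsOK n s x (f x))
proposition4p1 n s =
  toTarget n s , (respects , toTarget-injective n s , toTarget-surjective n s) , toTarget-stats n s
  where
  respects : (x y : WSP n s) → proj₁ x ≡ proj₁ y → proj₁ (toTarget n s x) ≡ proj₁ (toTarget n s y)
  respects _ _ refl = refl
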